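{- There exists an absolute constant $c>0$ such that the following holds. Let $G$ be an $n$-vertex graph with a designated Hamiltonian cycle $\mathscr{C}$. If $G$ contains a set $I$ of $2m$ independent chords, for some integer $m\ge 1$, which can be partitioned into $m$ pairs such that the two chords in each pair interlace, then $G$ contains a cycle distinct from $\mathscr{C}$ that misses at most $cn/m^{1/3}$ vertices of $G$.
   Context: Let $G$ be a graph with a designated Hamiltonian cycle $\mathscr{C}$ (a cycle through all vertices). A chord is an edge of $G$ not in $\mathscr{C}$. A set of chords is independent if no two of its chords share an endpoint. Two chords interlace if their four endpoints are distinct and appear in alternating order around $\mathscr{C}$. A cycle "misses" a vertex if the vertex is not on the cycle. The paper states the conclusion as "misses $O(n/m^{1/3})$ vertices", meaning at most an absolute constant times $n/m^{1/3}$. -}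

module Defs where

open import Data.Nat using (ℕ; zero; suc; _+_; _*_; _∸_; _^_; _≤_; _<_)
open import Data.Fin using (Fin; toℕ)
open import Data.Bool using (Bool)
open import Data.Product using (Σ; ∃; _×_; _,_)
open import Data.Sum using (_⊎_)
open import Relation.Nullary using (¬_)
open import Relation.Binary.PropositionalEquality using (_≡_; _≢_)
open import Function.Definitions using (Injective)

record Graph (n : ℕ) : Set₁ where
  field
    Adj     : Fin n → Fin n → Set
    sym     : ∀ {u v} → Adj u v → Adj v u
    irrefl  : ∀ {u} → ¬ Adj u u

open Graph public

CycSucc : (l : ℕ) → Fin l → Fin l → Set
CycSucc l i j = (suc (toℕ i) ≡ toℕ j) ⊎ ((suc (toℕ i) ≡ l) × (toℕ j ≡ 0))

-- A designated Hamiltonian cycle, given by the cyclic position ord v of each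
-- vertex v (ord is a bijection Fin n → Fin n); consecutive vertices are adjacent.
record HamCycle {n : ℕ} (G : Graph n) : Set where
  field
    three≤n : 3 ≤ n
    ord     : Fin n → Fin n
    ord-inj : Injective _≡_ _≡_ ord
    edges   : ∀ u v → CycSucc n (ord u) (ord v) → Adj G u v

open HamCycle public

module _ {n : ℕ} {G : Graph n} (C : HamCycle G) where

  CEdge : Fin n → Fin n → Set
  CEdge u v = CycSucc n (ord C u) (ord C v) ⊎ CycSucc n (ord C v) (ord C u)

  Chord : Fin n → Fin n → Set
  Chord u v = Adj G u v × ¬ CEdge u v

  Between : Fin n → Fin n → Fin n → Set
  Between a b p = (toℕ a < toℕ p × toℕ p < toℕ b) ⊎ (toℕ b < toℕ p × toℕ p < toℕ a)

  Interlace : Fin n → Fin n → Fin n → Fin n → Set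
  Interlace u v x y =
    (u ≢ v × u ≢ x × u ≢ y × v ≢ x × v ≢ y × x ≢ y) ×
    ((Between (ord C u) (ord C v) (ord C x) × ¬ Between (ord C u) (ord C v) (ord C y))
     ⊎ (¬ Between (ord C u) (ord C v) (ord C x) × Between (ord C u) (ord C v) (ord C y)))

  -- A set I of 2m independent chords partitioned into m interlacing pairs.
  -- ends k b s : pair k, chord b of the pair, endpoint s of the chord.
  record InterlacedPairs (m : ℕ) : Set where
    field
      ends      : Fin m → Bool → Bool → Fin n
      -- independence: the 4m endpoints are pairwise distinct
      ends-inj  : ∀ k b s k' b' s' → ends k b s ≡ ends k' b' s' →
                  (k ≡ k') × (b ≡ b') × (s ≡ s')
      chord     : ∀ k b → Chord (ends k b Bool.false) (ends k b Bool.true)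
      interlace : ∀ k → Interlace (ends k Bool.false Bool.false) (ends k Bool.false Bool.true)
                                  (ends k Bool.true Bool.false) (ends k Bool.true Bool.true)

record Cycle {n : ℕ} (G : Graph n) : Set where
  field
    len     : ℕ
    three≤l : 3 ≤ len
    cyc     : Fin len → Fin n
    cyc-inj : Injective _≡_ _≡_ cyc
    edges   : ∀ i j → CycSucc len i j → Adj G (cyc i) (cyc j)

open Cycle public

KEdge : {n : ℕ} {G : Graph n} → Cycle G → Fin n → Fin n → Set
KEdge K u v = ∃ λ i → ∃ λ j → CycSucc (len K) i j ×
  (((cyc K i ≡ u) × (cyc K j ≡ v)) ⊎ ((cyc K i ≡ v) × (cyc K j ≡ u)))

-- K is distinct from C (as subgraphs: their edge sets differ)
DistinctFrom : {n : ℕ} {G : Graph n} → Cycle G → HamCycle G → Set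
DistinctFrom K C = ¬ (∀ u v → (KEdge K u v → CEdge C u v) × (CEdge C u v → KEdge K u v))

-- number of vertices of G missed by K (vertices of K are distinct)
missed : {n : ℕ} {G : Graph n} → Cycle G → ℕ
missed {n} K = n ∸ len K

module Submission where

open import Defs
open import Data.Nat using (ℕ; _*_; _^_; _≤_; _<_)
open import Data.Product using (Σ; _×_)

open import Data.Nat using (zero; suc; _+_; _∸_; z≤n; s≤s; _<?_; _≤?_; NonZero; >-nonZero)
import Data.Nat as ℕ
open import Data.Nat.Properties
open import Data.Nat.DivMod using (_/_; m/n*n≤m; m≡m%n+[m/n]*n; m%n<n; /-monoˡ-≤; m<n*o⇒m/o<n)
open import Data.Nat.ListAction using (sum)
open import Data.Nat.Tactic.RingSolver using (solve-∀)
open import Data.Fin as Fin using (Fin; toℕ; fromℕ<; _↑ˡ_; _↑ʳ_)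
import Data.Fin.Properties as FinP
open import Data.Bool using (Bool; true; false; not)
import Data.Bool as Bool
open import Data.List using (List; []; _∷_; length)
open import Data.List.Relation.Unary.All using (All; []; _∷_; lookupAny)
open import Data.List.Relation.Unary.Any as Any using (Any; here; there)
open import Data.List.Relation.Unary.AllPairs using (AllPairs; []; _∷_)
open import Data.Product using (_,_; proj₁; proj₂)
open import Data.Product.Properties using (≡-dec)
open import Data.Sum using (_⊎_; inj₁; inj₂)
open import Data.Unit using (⊤; tt)
open import Data.Empty using (⊥; ⊥-elim)
open import Relation.Nullary using (¬_; Dec; yes; no)
open import Relation.Nullary.Decidable using (_×-dec_)
open import Relation.Binary.Definitions using (tri<; tri≈; tri>)
open import Relation.Binary.PropositionalEquality
  using (_≡_; _≢_; refl; trans; cong; subst; subst₂; module ≡-Reasoning) renaming (sym to ≡-sym)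
open import Function.Definitions using (Injective)

-- Positions 0 … n-1 along C are cut into k arcs, where 10 k³ < m ≤ 10 (k+1)³.
-- A cycle made of long runs of C joined by chords, which skips only a bounded
-- number of stretches lying inside single arcs, misses O(n / k) vertices
-- ("short").  Sorting each pair into a crossing a < c < b < d, either one of
-- its chords lies within an arc or both chords join the same two arcs (a short
-- cycle at once), or the pair gets one of 5 k³ classes recording which of its
-- four arcs coincide.  If a chord has no other chord of I joining the same two
-- arcs it is "thin"; two pairs cannot share a thin class, and three pairs
-- sharing any other class always combine into a short cycle.  As m > 2 · 5 k³,
-- the triple pigeonhole principle finishes the proof.

injective⇒surjective : ∀ {n} (f : Fin n → Fin n) → Injective _≡_ _≡_ f →
                       (y : Fin n) → Σ (Fin n) λ x → f x ≡ y
injective⇒surjective {suc n} f f-inj y with FinP.any? (λ x → f x FinP.≟ y)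
... | yes hit = hit
... | no miss = ⊥-elim (1+n≰n (FinP.injective⇒≤ squeeze-injective))
  where
  -- without a preimage of y, f would inject Fin (suc n) into Fin n
  squeeze : Fin (suc n) → Fin n
  squeeze x = Fin.punchOut {i = y} {j = f x} (λ e → miss (x , ≡-sym e))
  squeeze-injective : Injective _≡_ _≡_ squeeze
  squeeze-injective {x} {x'} e =
    f-inj (FinP.punchOut-injective (λ e → miss (x , ≡-sym e)) (λ e → miss (x' , ≡-sym e)) e)

-- Tag each point by whether its value
-- already occurred at a smaller point; the ordinary pigeonhole principle for
-- (tag, value) ∈ Fin (K + K) then finds two points with the same tagged
-- value, and the earlier occurrence behind the tag is the third point.
module _ {m K : ℕ} (f : Fin m → Fin K) where

  Repeated : Fin m → Set
  Repeated x = Σ (Fin m) λ y → toℕ y < toℕ x × f y ≡ f x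

  repeated? : ∀ x → Dec (Repeated x)
  repeated? x = FinP.any? (λ y → (toℕ y <? toℕ x) ×-dec (f y FinP.≟ f x))

  tagged : (x : Fin m) → Dec (Repeated x) → Fin (K + K)
  tagged x (yes _) = K ↑ʳ f x
  tagged x (no _) = f x ↑ˡ K

  ↑ˡ≢↑ʳ : ∀ (u v : Fin K) → u ↑ˡ K ≢ K ↑ʳ v
  ↑ˡ≢↑ʳ u v e = <⇒≱ (subst (_< K) (≡-sym (FinP.toℕ-↑ˡ u K)) (FinP.toℕ<n u))
                    (subst (K ≤_) (trans (≡-sym (FinP.toℕ-↑ʳ K v)) (cong toℕ (≡-sym e))) (m≤m+n K (toℕ v)))

  ThreeAlike : Set
  ThreeAlike = Σ (Fin m) λ i → Σ (Fin m) λ j → Σ (Fin m) λ l → i ≢ j × j ≢ l × i ≢ l × f i ≡ f j × f j ≡ f l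

  collide : ∀ i j → toℕ i < toℕ j → (ri : Dec (Repeated i)) (rj : Dec (Repeated j)) →
            tagged i ri ≡ tagged j rj → ThreeAlike
  collide i j i<j (yes (y , y<i , fy≡)) (yes _) e =
    y , i , j , FinP.<⇒≢ y<i , FinP.<⇒≢ i<j , FinP.<⇒≢ (<-trans y<i i<j) , fy≡ , FinP.↑ʳ-injective K (f i) (f j) e
  collide i j i<j (no _) (no fresh) e = ⊥-elim (fresh (i , i<j , FinP.↑ˡ-injective K (f i) (f j) e))
  collide i j i<j (yes _) (no _) e = ⊥-elim (↑ˡ≢↑ʳ (f j) (f i) (≡-sym e))
  collide i j i<j (no _) (yes _) e = ⊥-elim (↑ˡ≢↑ʳ (f i) (f j) e)

  threeAlike : K + K < m → ThreeAlike
  threeAlike 2K<m with i , j , i<j , same ← FinP.pigeonhole 2K<m (λ x → tagged x (repeated? x))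
    = collide i j i<j (repeated? i) (repeated? j) same

findOrAll : ∀ {M} {A : Set} {B : Fin M → Set} → (∀ i → A ⊎ B i) → A ⊎ ((i : Fin M) → B i)
findOrAll {ℕ.zero} h = inj₂ (λ ())
findOrAll {ℕ.suc M} {B = B} h with h Fin.zero | findOrAll {M} {B = λ i → B (Fin.suc i)} (λ i → h (Fin.suc i))
... | inj₁ a | _ = inj₁ a
... | inj₂ _ | inj₁ a = inj₁ a
... | inj₂ b | inj₂ f = inj₂ (λ { Fin.zero → b ; (Fin.suc i) → f i })

sortThree : ∀ {A : Set} {R : Set} (D : A → A → Set) → (∀ {x y} → D x y → D y x) →
            (Q : A → Set) (v : A → ℕ) (x y z : A) → Q x → Q y → Q z →
            D x y → D y z → D x z → v x ≢ v y → v y ≢ v z → v x ≢ v z →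
            (∀ p q r → Q p → Q q → Q r → D p q → D q r → D p r → v p < v q → v q < v r → R) → R
sortThree D D-sym Q v x y z qx qy qz dxy dyz dxz nxy nyz nxz sorted
  with <-cmp (v x) (v y) | <-cmp (v y) (v z) | <-cmp (v x) (v z)
... | tri≈ _ e _ | _ | _ = ⊥-elim (nxy e)
... | _ | tri≈ _ e _ | _ = ⊥-elim (nyz e)
... | _ | _ | tri≈ _ e _ = ⊥-elim (nxz e)
... | tri< l₁ _ _ | tri< l₂ _ _ | _ = sorted x y z qx qy qz dxy dyz dxz l₁ l₂
... | tri< _ _ _ | tri> _ _ l₂ | tri< l₃ _ _ = sorted x z y qx qz qy dxz (D-sym dyz) dxy l₃ l₂
... | tri< l₁ _ _ | tri> _ _ _ | tri> _ _ l₃ = sorted z x y qz qx qy (D-sym dxz) dxy (D-sym dyz) l₃ l₁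
... | tri> _ _ l₁ | tri< _ _ _ | tri< l₃ _ _ = sorted y x z qy qx qz (D-sym dxy) dxz dyz l₁ l₃
... | tri> _ _ _ | tri< l₂ _ _ | tri> _ _ l₃ = sorted y z x qy qz qx dyz (D-sym dxz) (D-sym dxy) l₂ l₃
... | tri> _ _ l₁ | tri> _ _ l₂ | _ = sorted z y x qz qy qx (D-sym dyz) (D-sym dxy) (D-sym dxz) l₂ l₁

module Positions {n : ℕ} {G : Graph n} (C : HamCycle G) where

  pos : Fin n → ℕ
  pos v = toℕ (ord C v)

  pos<n : ∀ v → pos v < n
  pos<n v = FinP.toℕ<n (ord C v)

  pos-injective : ∀ {u v} → pos u ≡ pos v → u ≡ v
  pos-injective e = ord-inj C (FinP.toℕ-injective e)

  0<n : 0 < n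
  0<n = ≤-trans (s≤s z≤n) (three≤n C)

  -- vertexAt is the inverse of pos (and arbitrary on positions ≥ n)
  vertexAt : ℕ → Fin n
  vertexAt p with p <? n
  ... | yes p<n = proj₁ (injective⇒surjective (ord C) (ord-inj C) (fromℕ< p<n))
  ... | no _ = fromℕ< 0<n

  pos-vertexAt : ∀ p → p < n → pos (vertexAt p) ≡ p
  pos-vertexAt p p<n with p <? n
  ... | yes q = trans (cong toℕ (proj₂ (injective⇒surjective (ord C) (ord-inj C) (fromℕ< q))))
                      (FinP.toℕ-fromℕ< q)
  ... | no p≮n = ⊥-elim (p≮n p<n)

  vertexAt-pos : ∀ v → vertexAt (pos v) ≡ v
  vertexAt-pos v = pos-injective (pos-vertexAt (pos v) (pos<n v))

  vertexAt-injective : ∀ {p q} → p < n → q < n → vertexAt p ≡ vertexAt q → p ≡ q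
  vertexAt-injective {p} {q} p<n q<n e =
    trans (≡-sym (pos-vertexAt p p<n)) (trans (cong pos e) (pos-vertexAt q q<n))

  E : ℕ → ℕ → Set
  E p q = Adj G (vertexAt p) (vertexAt q)

  CE : ℕ → ℕ → Set
  CE p q = CEdge C (vertexAt p) (vertexAt q)

  ChordAt : ℕ → ℕ → Set
  ChordAt p q = E p q × ¬ CE p q

  E-sym : ∀ {p q} → E p q → E q p
  E-sym = Graph.sym G

  CE-sym : ∀ {p q} → CE p q → CE q p
  CE-sym (inj₁ e) = inj₂ e
  CE-sym (inj₂ e) = inj₁ e

  ChordAt-sym : ∀ {p q} → ChordAt p q → ChordAt q p
  ChordAt-sym (e , ¬c) = E-sym e , λ c → ¬c (CE-sym c)

  lastPos : ℕ
  lastPos = n ∸ 1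

  suc-lastPos : suc lastPos ≡ n
  suc-lastPos = m+[n∸m]≡n {1} {n} 0<n

  CE-succ : ∀ p → suc p < n → CE p (suc p)
  CE-succ p sp<n = inj₁ (inj₁ (trans (cong suc (pos-vertexAt p (≤-trans (n≤1+n _) sp<n)))
                                     (≡-sym (pos-vertexAt (suc p) sp<n))))

  CE-wrap : CE lastPos 0
  CE-wrap = inj₁ (inj₂ (trans (cong suc (pos-vertexAt lastPos lastPos<n)) suc-lastPos , pos-vertexAt 0 0<n))
    where
    lastPos<n : lastPos < n
    lastPos<n = subst (lastPos <_) suc-lastPos ≤-refl

  cycleEdge : ∀ {p q} → CE p q → E p q
  cycleEdge {p} {q} (inj₁ s) = HamCycle.edges C (vertexAt p) (vertexAt q) s
  cycleEdge {p} {q} (inj₂ s) = E-sym (HamCycle.edges C (vertexAt q) (vertexAt p) s)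

  E-succ : ∀ p → suc p < n → E p (suc p)
  E-succ p sp<n = cycleEdge (CE-succ p sp<n)

  E-wrap : E lastPos 0
  E-wrap = cycleEdge CE-wrap

  E-of : ∀ {u v} → Adj G u v → E (pos u) (pos v)
  E-of {u} {v} a = subst₂ (Adj G) (≡-sym (vertexAt-pos u)) (≡-sym (vertexAt-pos v)) a

  ¬CE-of : ∀ {u v} → ¬ CEdge C u v → ¬ CE (pos u) (pos v)
  ¬CE-of {u} {v} h = subst₂ (λ a b → ¬ CEdge C a b) (≡-sym (vertexAt-pos u)) (≡-sym (vertexAt-pos v)) h

module Paths {n : ℕ} {G : Graph n} (C : HamCycle G) where
  open Positions C

  record Path : Set where
    field
      size         : ℕ
      size≥1       : 1 ≤ size
      at           : ℕ → ℕ
      at<n         : ∀ i → i < size → at i < n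
      at-injective : ∀ i j → i < size → j < size → at i ≡ at j → i ≡ j
      step         : ∀ i → suc i < size → E (at i) (at (suc i))

  open Path public

  first last : Path → ℕ
  first π = at π 0
  last π = at π (size π ∸ 1)

  Visits : Path → ℕ → Set
  Visits π p = Σ ℕ λ i → i < size π × at π i ≡ p

  pred< : ∀ {L} → 1 ≤ L → L ∸ 1 < L
  pred< {suc L} _ = ≤-refl

  module Concat (π₁ π₂ : Path) (disjoint : ∀ p → Visits π₁ p → Visits π₂ p → ⊥)
                (link : E (last π₁) (first π₂)) where
    L₁ L₂ : ℕ
    L₁ = size π₁
    L₂ = size π₂

    walk : ℕ → ℕ
    walk i with i <? L₁
    ... | yes _ = at π₁ i
    ... | no _ = at π₂ (i ∸ L₁)

    walk-left : ∀ i → i < L₁ → walk i ≡ at π₁ i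
    walk-left i i< with i <? L₁
    ... | yes _ = refl
    ... | no i≮ = ⊥-elim (i≮ i<)

    walk-right : ∀ i → L₁ ≤ i → walk i ≡ at π₂ (i ∸ L₁)
    walk-right i le with i <? L₁
    ... | yes i< = ⊥-elim (<⇒≱ i< le)
    ... | no _ = refl

    right< : ∀ i → L₁ ≤ i → i < L₁ + L₂ → i ∸ L₁ < L₂
    right< i le lt = +-cancelˡ-< L₁ (i ∸ L₁) L₂ (subst (_< L₁ + L₂) (≡-sym (m+[n∸m]≡n le)) lt)

    step-link : ∀ i → i < L₁ → L₁ ≤ suc i → E (walk i) (walk (suc i))
    step-link i i< L₁≤ = subst₂ E (≡-sym (walk-left i i<)) (≡-sym (walk-right (suc i) L₁≤))
                                  (subst₂ E (cong (at π₁) (cong (_∸ 1) (≡-sym i≡))) (cong (at π₂) 0≡) link)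
      where
      i≡ : suc i ≡ L₁
      i≡ = ≤-antisym i< L₁≤
      0≡ : 0 ≡ suc i ∸ L₁
      0≡ = ≡-sym (trans (cong (_∸ L₁) i≡) (n∸n≡0 L₁))

    step-right : ∀ i → L₁ ≤ i → suc i < L₁ + L₂ → E (walk i) (walk (suc i))
    step-right i L₁≤i si< =
      subst₂ E (≡-sym (walk-right i L₁≤i)) (≡-sym (walk-right (suc i) (≤-trans L₁≤i (n≤1+n i))))
        (subst (λ z → E (at π₂ (i ∸ L₁)) (at π₂ z)) (≡-sym (+-∸-assoc 1 L₁≤i))
          (step π₂ (i ∸ L₁) (subst (_< L₂) (+-∸-assoc 1 L₁≤i) (right< (suc i) (≤-trans L₁≤i (n≤1+n i)) si<))))

    side : ∀ i → i < L₁ ⊎ L₁ ≤ i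
    side i with i <? L₁
    ... | yes l = inj₁ l
    ... | no r = inj₂ (≮⇒≥ r)

    path : Path
    size path = L₁ + L₂
    size≥1 path = ≤-trans (size≥1 π₁) (m≤m+n L₁ L₂)
    at path = walk
    at<n path i i< with side i
    ... | inj₁ l = subst (_< n) (≡-sym (walk-left i l)) (at<n π₁ i l)
    ... | inj₂ r = subst (_< n) (≡-sym (walk-right i r)) (at<n π₂ (i ∸ L₁) (right< i r i<))
    at-injective path i j i< j< e with side i | side j
    ... | inj₁ l | inj₁ l' = at-injective π₁ i j l l' (trans (≡-sym (walk-left i l)) (trans e (walk-left j l')))
    ... | inj₂ r | inj₂ r' = trans (≡-sym (m+[n∸m]≡n r)) (trans (cong (L₁ +_) shifted) (m+[n∸m]≡n r'))
      where
      shifted : i ∸ L₁ ≡ j ∸ L₁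
      shifted = at-injective π₂ (i ∸ L₁) (j ∸ L₁) (right< i r i<) (right< j r' j<)
                  (trans (≡-sym (walk-right i r)) (trans e (walk-right j r')))
    ... | inj₁ l | inj₂ r' = ⊥-elim (disjoint (at π₁ i) (i , l , refl)
                               (j ∸ L₁ , right< j r' j< , ≡-sym (trans (≡-sym (walk-left i l)) (trans e (walk-right j r')))))
    ... | inj₂ r | inj₁ l' = ⊥-elim (disjoint (at π₁ j) (j , l' , refl)
                               (i ∸ L₁ , right< i r i< , trans (≡-sym (walk-right i r)) (trans e (walk-left j l'))))
    step path i si< with side (suc i) | side i
    ... | inj₁ l | _ = subst₂ E (≡-sym (walk-left i (≤-trans (n≤1+n _) l))) (≡-sym (walk-left (suc i) l)) (step π₁ i l)
    ... | inj₂ r | inj₁ l = step-link i l r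
    ... | inj₂ _ | inj₂ r = step-right i r si<

    first-path : first path ≡ first π₁
    first-path = walk-left 0 (size≥1 π₁)

    last-path : last path ≡ last π₂
    last-path = trans (walk-right (L₁ + L₂ ∸ 1) L₁≤) (cong (at π₂) shift)
      where
      L₁≤ : L₁ ≤ L₁ + L₂ ∸ 1
      L₁≤ = subst (L₁ ≤_) (≡-sym (+-∸-assoc L₁ (size≥1 π₂))) (m≤m+n L₁ (L₂ ∸ 1))
      shift : L₁ + L₂ ∸ 1 ∸ L₁ ≡ L₂ ∸ 1
      shift = trans (cong (_∸ L₁) (+-∸-assoc L₁ (size≥1 π₂))) (m+n∸m≡n L₁ (L₂ ∸ 1))

    visits-path : ∀ p → Visits path p → Visits π₁ p ⊎ Visits π₂ p
    visits-path p (i , i< , e) with side i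
    ... | inj₁ l = inj₁ (i , l , trans (≡-sym (walk-left i l)) e)
    ... | inj₂ r = inj₂ (i ∸ L₁ , right< i r i< , trans (≡-sym (walk-right i r)) e)

  closePath : (π : Path) → 3 ≤ size π → ChordAt (last π) (first π) →
              Σ (Cycle G) λ K → DistinctFrom K C × len K ≡ size π
  closePath π three (closing , notC) = K , distinct , refl
    where
    K : Cycle G
    Cycle.len K = size π
    Cycle.three≤l K = three
    Cycle.cyc K i = vertexAt (at π (toℕ i))
    Cycle.cyc-inj K {i} {j} e = FinP.toℕ-injective
      (at-injective π (toℕ i) (toℕ j) (FinP.toℕ<n i) (FinP.toℕ<n j)
        (vertexAt-injective (at<n π _ (FinP.toℕ<n i)) (at<n π _ (FinP.toℕ<n j)) e))
    Cycle.edges K i j (inj₁ e) =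
      subst (λ z → E (at π (toℕ i)) (at π z)) e (step π (toℕ i) (subst (_< size π) (≡-sym e) (FinP.toℕ<n j)))
    Cycle.edges K i j (inj₂ (wraps , j≡0)) =
      subst₂ E (cong (at π) (cong (_∸ 1) (≡-sym wraps))) (cong (at π) (≡-sym j≡0)) closing
    -- the closing chord is an edge of K but not of C
    lastIndex firstIndex : Fin (size π)
    lastIndex = fromℕ< (pred< (size≥1 π))
    firstIndex = fromℕ< (size≥1 π)
    closingEdge : KEdge K (vertexAt (last π)) (vertexAt (first π))
    closingEdge = lastIndex , firstIndex
                , inj₂ (trans (cong suc (FinP.toℕ-fromℕ< _)) (m+[n∸m]≡n (size≥1 π)) , FinP.toℕ-fromℕ< _)
                , inj₁ (cong (λ z → vertexAt (at π z)) (FinP.toℕ-fromℕ< _) , cong (λ z → vertexAt (at π z)) (FinP.toℕ-fromℕ< _))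
    distinct : DistinctFrom K C
    distinct sameEdges = notC (proj₁ (sameEdges _ _) closingEdge)

  -- A run is the stretch of C between positions lo and lo + ext, walked
  -- upwards (starting at lo) or downwards (starting at lo + ext).
  data Direction : Set where
    up down : Direction

  record Run : Set where
    constructor run
    field
      dir    : Direction
      lo ext : ℕ

  open Run public

  hi entry exit : Run → ℕ
  hi r = lo r + ext r
  entry (run up l e) = l
  entry (run down l e) = l + e
  exit (run up l e) = l + e
  exit (run down l e) = l

  Covers : Run → ℕ → Set
  Covers r p = lo r ≤ p × p ≤ hi r

  InRange : Run → Set
  InRange r = hi r < n

  runPath : (r : Run) → InRange r → Path
  size (runPath r _) = suc (ext r)
  size≥1 (runPath r _) = s≤s z≤n
  at (runPath (run up l e) _) i = l + i
  at (runPath (run down l e) _) i = l + e ∸ i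
  at<n (runPath (run up l e) h) i i< = ≤-<-trans (+-monoʳ-≤ l (≤-pred i<)) h
  at<n (runPath (run down l e) h) i i< = ≤-<-trans (m∸n≤m (l + e) i) h
  at-injective (runPath (run up l e) _) i j _ _ eq = +-cancelˡ-≡ l i j eq
  at-injective (runPath (run down l e) _) i j i< j< eq =
    ∸-cancelˡ-≡ (≤-trans (≤-pred i<) (m≤n+m e l)) (≤-trans (≤-pred j<) (m≤n+m e l)) eq
  step (runPath (run up l e) h) i si< =
    subst (E (l + i)) (≡-sym (+-suc l i))
      (E-succ (l + i) (≤-<-trans (subst (_≤ l + e) (+-suc l i) (+-monoʳ-≤ l (≤-pred si<))) h))
  step (runPath (run down l e) h) i si< =
    subst (λ z → E z (l + e ∸ suc i)) below (E-sym (E-succ (l + e ∸ suc i) (subst (_< n) (≡-sym below) (≤-<-trans (m∸n≤m (l + e) i) h))))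
    where
    below : suc (l + e ∸ suc i) ≡ l + e ∸ i
    below = ≡-sym (+-∸-assoc 1 (≤-trans (≤-pred si<) (m≤n+m e l)))

  runPath-first : ∀ r h → first (runPath r h) ≡ entry r
  runPath-first (run up l e) h = +-identityʳ l
  runPath-first (run down l e) h = refl

  runPath-last : ∀ r h → last (runPath r h) ≡ exit r
  runPath-last (run up l e) h = refl
  runPath-last (run down l e) h = m+n∸n≡m l e

  runPath-visits : ∀ r h p → Visits (runPath r h) p → Covers r p
  runPath-visits (run up l e) h p (i , i< , refl) = m≤m+n l i , +-monoʳ-≤ l (≤-pred i<)
  runPath-visits (run down l e) h p (i , i< , refl) =
    subst (_≤ l + e ∸ i) (m+n∸n≡m l e) (∸-monoʳ-≤ (l + e) (≤-pred i<)) , m∸n≤m (l + e) i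

  Apart : Run → Run → Set
  Apart r s = hi r < lo s ⊎ hi s < lo r

  apart-disjoint : ∀ {r s p} → Apart r s → Covers r p → Covers s p → ⊥
  apart-disjoint (inj₁ r<s) (_ , p≤hr) (ls≤p , _) = <⇒≱ r<s (≤-trans ls≤p p≤hr)
  apart-disjoint (inj₂ s<r) (lr≤p , _) (_ , p≤hs) = <⇒≱ s<r (≤-trans lr≤p p≤hs)

  Linked : Run → List Run → Set
  Linked r [] = ⊤
  Linked r (s ∷ rs) = E (exit r) (entry s) × Linked s rs

  final : Run → List Run → Run
  final r [] = r
  final r (s ∷ rs) = final s rs

  totalSize : List Run → ℕ
  totalSize [] = 0
  totalSize (r ∷ rs) = suc (ext r) + totalSize rs

  record Joined (r : Run) (rs : List Run) : Set where
    field
      path         : Path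
      path-first   : first path ≡ entry r
      path-last    : last path ≡ exit (final r rs)
      path-size    : size path ≡ totalSize (r ∷ rs)
      path-visits  : ∀ p → Visits path p → Any (λ s → Covers s p) (r ∷ rs)

  join : ∀ r rs → All InRange (r ∷ rs) → AllPairs Apart (r ∷ rs) → Linked r rs → Joined r rs
  join r [] (h ∷ []) _ _ = record
    { path = runPath r h
    ; path-first = runPath-first r h
    ; path-last = runPath-last r h
    ; path-size = ≡-sym (+-identityʳ _)
    ; path-visits = λ p v → here (runPath-visits r h p v) }
  join r (s ∷ rs) (h ∷ hs) (apart ∷ aparts) (link , links) = record
    { path = Concat.path π₁ π₂ disjoint link'
    ; path-first = trans (Concat.first-path π₁ π₂ disjoint link') (runPath-first r h)
    ; path-last = trans (Concat.last-path π₁ π₂ disjoint link') (Joined.path-last rest)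
    ; path-size = cong (suc (ext r) +_) (Joined.path-size rest)
    ; path-visits = visits }
    where
    rest : Joined s rs
    rest = join s rs hs aparts links
    π₁ π₂ : Path
    π₁ = runPath r h
    π₂ = Joined.path rest
    disjoint : ∀ p → Visits π₁ p → Visits π₂ p → ⊥
    disjoint p v₁ v₂ = apart-disjoint {r} {Any.lookup covering} {p} r-apart (runPath-visits r h p v₁) covered
      where
      covering : Any (λ t → Covers t p) (s ∷ rs)
      covering = Joined.path-visits rest p v₂
      r-apart : Apart r (Any.lookup covering)
      r-apart = proj₁ (lookupAny apart covering)
      covered : Covers (Any.lookup covering) p
      covered = proj₂ (lookupAny apart covering)
    link' : E (last π₁) (first π₂)
    link' = subst₂ E (≡-sym (runPath-last r h)) (≡-sym (Joined.path-first rest)) link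
    visits : ∀ p → Visits (Concat.path π₁ π₂ disjoint link') p → Any (λ t → Covers t p) (r ∷ s ∷ rs)
    visits p v with Concat.visits-path π₁ π₂ disjoint link' p v
    ... | inj₁ v₁ = here (runPath-visits r h p v₁)
    ... | inj₂ v₂ = there (Joined.path-visits rest p v₂)

  cycleOfRuns : ∀ r rs → All InRange (r ∷ rs) → AllPairs Apart (r ∷ rs) → Linked r rs →
                3 ≤ totalSize (r ∷ rs) → ChordAt (exit (final r rs)) (entry r) →
                Σ (Cycle G) λ K → DistinctFrom K C × len K ≡ totalSize (r ∷ rs)
  cycleOfRuns r rs inRange aparts links three closing
    with closePath path (subst (3 ≤_) (≡-sym path-size) three)
                        (subst₂ ChordAt (≡-sym path-last) (≡-sym path-first) closing)
    where open Joined (join r rs inRange aparts links)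
  ... | K , distinct , len≡ = K , distinct , trans len≡ (Joined.path-size (join r rs inRange aparts links))

  three≤totalSize : ∀ r s t rs → 3 ≤ totalSize (r ∷ s ∷ t ∷ rs)
  three≤totalSize r s t rs =
    s≤s (≤-trans (s≤s (≤-trans (s≤s z≤n) (m≤n+m _ (ext s)))) (m≤n+m _ (ext r)))

module Configurations {n : ℕ} {G : Graph n} (C : HamCycle G) where
  open Positions C
  open Paths C

  Good : ℕ → Set
  Good g = Σ (Cycle G) λ K → DistinctFrom K C × missed K ≤ g

  goodOfRuns : ∀ {g} r rs → All InRange (r ∷ rs) → AllPairs Apart (r ∷ rs) → Linked r rs →
               3 ≤ totalSize (r ∷ rs) → ChordAt (exit (final r rs)) (entry r) →
               totalSize (r ∷ rs) + g ≡ n → Good g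
  goodOfRuns {g} r rs inRange aparts links three closing sizes
    with cycleOfRuns r rs inRange aparts links three closing
  ... | K , distinct , len≡ = K , distinct , ≤-reflexive (begin
    n ∸ len K                           ≡⟨ cong (n ∸_) len≡ ⟩
    n ∸ totalSize (r ∷ rs)              ≡⟨ cong (_∸ totalSize (r ∷ rs)) (≡-sym sizes) ⟩
    totalSize (r ∷ rs) + g ∸ totalSize (r ∷ rs) ≡⟨ m+n∸m≡n (totalSize (r ∷ rs)) g ⟩
    g                                   ∎)
    where open ≡-Reasoning

  three≤two-runs : ∀ t l → (t ≡ 0 → l ≡ 0 → ⊥) → 3 ≤ suc t + (suc l + 0)
  three≤two-runs (suc t) l _ = s≤s (s≤s (≤-trans (s≤s z≤n) (m≤n+m _ t)))
  three≤two-runs zero (suc l) _ = s≤s (s≤s (s≤s z≤n))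
  three≤two-runs zero zero degenerate = ⊥-elim (degenerate refl refl)

  <-split : ∀ {p q} → p < q → Σ ℕ λ g → q ≡ p + suc g
  <-split {p} lt with m≤n⇒∃[o]m+o≡n lt
  ... | o , e = o , trans (≡-sym e) (≡-sym (+-suc p o))

  ≤-split : ∀ {p q} → p ≤ q → Σ ℕ λ r → q ≡ p + r
  ≤-split le with m≤n⇒∃[o]m+o≡n le
  ... | o , e = o , ≡-sym e

  <+suc : ∀ a b → a < a + suc b
  <+suc a b = m<m+n a (s≤s z≤n)

  gap≤ : ∀ p g → g ≤ (p + suc g) ∸ p
  gap≤ p g = ≤-trans (n≤1+n g) (≤-reflexive (≡-sym (m+n∸m≡n p (suc g))))

  lastPos≡ : ∀ h t → n ≡ h + suc t → lastPos ≡ h + t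
  lastPos≡ h t e = cong (_∸ 1) (trans e (+-suc h t))

  toTop : ∀ h t → n ≡ h + suc t → h + t < n
  toTop h t e = subst (h + t <_) (≡-sym (trans e (+-suc h t))) ≤-refl

  -- One chord lo–hi: go from hi up to the last position, wrap to 0, go up to
  -- lo and close along the chord; the cycle misses the vertices strictly
  -- between lo and hi.
  oneChord : ∀ lo hi → lo < hi → hi < n → ChordAt lo hi → Σ ℕ λ g → Good g × g ≤ sum (hi ∸ lo ∷ [])
  oneChord lo hi lo<hi hi<n chord with <-split lo<hi | <-split hi<n
  ... | g , refl | t , e = g , goodOfRuns R₁ (R₂ ∷ []) inRange aparts links (three≤two-runs t lo degenerate) chord sizes , ≤-trans (gap≤ lo g) (m≤m+n _ 0)
    where
    R₁ R₂ : Run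
    R₁ = run up (lo + suc g) t
    R₂ = run up 0 lo
    inRange : All InRange (R₁ ∷ R₂ ∷ [])
    inRange = toTop _ t e ∷ <-trans (<+suc lo g) hi<n ∷ []
    aparts : AllPairs Apart (R₁ ∷ R₂ ∷ [])
    aparts = (inj₂ (<+suc lo g) ∷ []) ∷ [] ∷ []
    links : Linked R₁ (R₂ ∷ [])
    links = subst (λ z → E z 0) (lastPos≡ _ t e) E-wrap , tt
    -- with only two vertices the chord would be the C-edge lastPos–0
    degenerate : t ≡ 0 → lo ≡ 0 → ⊥
    degenerate refl refl = proj₂ chord (CE-sym (subst₂ CE (trans (lastPos≡ _ 0 e) (+-identityʳ _)) refl CE-wrap))
    sizes : totalSize (R₁ ∷ R₂ ∷ []) + g ≡ n
    sizes = trans (count t lo g) (≡-sym e)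
      where
      count : ∀ t lo g → suc t + (suc lo + 0) + g ≡ lo + suc g + suc t
      count = solve-∀

  -- Two crossing chords x–q and p'–q' with x < p' < q < q': walk p' … q,
  -- jump to x, walk down to 0, wrap to the last position, walk down to q' and
  -- close along q'–p'.  Missed: the vertices between x and p' and between q and q'.
  crossingPair : ∀ x p' q q' → x < p' → p' < q → q < q' → q' < n → E x q → ChordAt p' q' →
                 Σ ℕ λ g → Good g × g ≤ sum (p' ∸ x ∷ q' ∸ q ∷ [])
  crossingPair x p' q q' x<p' p'<q q<q' q'<n exq chord with <-split x<p' | <-split p'<q | <-split q<q' | <-split q'<n
  ... | g₁ , refl | u , refl | g₂ , refl | t , e =
    g₁ + (g₂ + 0) , goodOfRuns R₁ (R₂ ∷ R₃ ∷ []) inRange aparts links (three≤totalSize R₁ R₂ R₃ []) (ChordAt-sym chord) sizes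
            , +-mono-≤ (gap≤ x g₁) (+-mono-≤ (gap≤ q g₂) ≤-refl)
    where
    R₁ R₂ R₃ : Run
    R₁ = run up p' (suc u)
    R₂ = run down 0 x
    R₃ = run down q' t
    x<q' : x < q'
    x<q' = <-trans (<+suc x g₁) (<-trans (<+suc p' u) (<+suc q g₂))
    inRange : All InRange (R₁ ∷ R₂ ∷ R₃ ∷ [])
    inRange = <-trans (<+suc q g₂) q'<n ∷ <-trans x<q' q'<n ∷ toTop q' t e ∷ []
    aparts : AllPairs Apart (R₁ ∷ R₂ ∷ R₃ ∷ [])
    aparts = (inj₂ (<+suc x g₁) ∷ inj₁ (<+suc _ g₂) ∷ [])
           ∷ (inj₁ x<q' ∷ [])
           ∷ [] ∷ []
    links : Linked R₁ (R₂ ∷ R₃ ∷ [])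
    links = E-sym exq , subst (E 0) (lastPos≡ _ t e) (E-sym E-wrap) , tt
    sizes : totalSize (R₁ ∷ R₂ ∷ R₃ ∷ []) + (g₁ + (g₂ + 0)) ≡ n
    sizes = trans (count x g₁ u g₂ t) (≡-sym e)
      where
      count : ∀ x g₁ u g₂ t → suc (suc u) + (suc x + (suc t + 0)) + (g₁ + (g₂ + 0)) ≡ x + suc g₁ + suc u + suc g₂ + suc t
      count = solve-∀

  -- The cycle
  --   y … top, 0 … a, b … y', x' … b', a' … x, back to y
  -- misses only the four short stretches a…a', x…x', b'…b and y'…y.
  nestedPairs : ∀ a a' x x' b' b y' y →
                a < a' → a' ≤ x → x < x' → x' ≤ b' → b' < b → b ≤ y' → y' < y → y < n →
                E a b → E a' b' → ChordAt x y → E x' y' →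
                Σ ℕ λ g → Good g × g ≤ sum (a' ∸ a ∷ x' ∸ x ∷ b ∸ b' ∷ y ∸ y' ∷ [])
  nestedPairs a a' x x' b' b y' y a<a' a'≤x x<x' x'≤b' b'<b b≤y' y'<y y<n eab ea'b' chord ex'y'
    with <-split a<a' | ≤-split a'≤x | <-split x<x' | ≤-split x'≤b' | <-split b'<b | ≤-split b≤y' | <-split y'<y | <-split y<n
  ... | g₁ , refl | r₁ , refl | g₂ , refl | r₂ , refl | g₃ , refl | r₃ , refl | g₄ , refl | t , e =
    g₁ + (g₂ + (g₃ + (g₄ + 0))) , goodOfRuns R₁ (R₂ ∷ R₃ ∷ R₄ ∷ R₅ ∷ []) inRange aparts links (three≤totalSize R₁ R₂ R₃ (R₄ ∷ R₅ ∷ [])) chord sizes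
                      , +-mono-≤ (gap≤ a g₁) (+-mono-≤ (gap≤ x g₂) (+-mono-≤ (gap≤ b' g₃) (+-mono-≤ (gap≤ y' g₄) ≤-refl)))
    where
    R₁ R₂ R₃ R₄ R₅ : Run
    R₁ = run up y t
    R₂ = run up 0 a
    R₃ = run up b r₃
    R₄ = run up x' r₂
    R₅ = run up a' r₁
    x<b : x < b
    x<b = <-≤-trans (<+suc x g₂) (≤-trans (m≤m+n x' r₂) (<⇒≤ (<+suc b' g₃)))
    x<y : x < y
    x<y = <-≤-trans x<b (≤-trans (m≤m+n b r₃) (<⇒≤ (<+suc y' g₄)))
    a<x : a < x
    a<x = <-≤-trans (<+suc a g₁) (m≤m+n a' r₁)
    b'<y : b' < y
    b'<y = <-trans (<+suc b' g₃) (≤-<-trans (m≤m+n b r₃) (<+suc y' g₄))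
    inRange : All InRange (R₁ ∷ R₂ ∷ R₃ ∷ R₄ ∷ R₅ ∷ [])
    inRange = toTop y t e ∷ <-trans (<-trans a<x x<y) y<n ∷ <-trans (<+suc y' g₄) y<n
            ∷ <-trans b'<y y<n ∷ <-trans x<y y<n ∷ []
    aparts : AllPairs Apart (R₁ ∷ R₂ ∷ R₃ ∷ R₄ ∷ R₅ ∷ [])
    aparts = (inj₂ (<-trans a<x x<y) ∷ inj₂ (<+suc y' g₄) ∷ inj₂ b'<y ∷ inj₂ x<y ∷ [])
           ∷ (inj₁ (<-trans a<x x<b) ∷ inj₁ (<-trans a<x (<+suc x g₂)) ∷ inj₁ (<+suc a g₁) ∷ [])
           ∷ (inj₂ (<+suc b' g₃) ∷ inj₂ x<b ∷ [])
           ∷ (inj₂ (<+suc x g₂) ∷ [])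
           ∷ [] ∷ []
    links : Linked R₁ (R₂ ∷ R₃ ∷ R₄ ∷ R₅ ∷ [])
    links = subst (λ z → E z 0) (lastPos≡ y t e) E-wrap , eab , E-sym ex'y' , E-sym ea'b' , tt
    sizes : totalSize (R₁ ∷ R₂ ∷ R₃ ∷ R₄ ∷ R₅ ∷ []) + (g₁ + (g₂ + (g₃ + (g₄ + 0)))) ≡ n
    sizes = trans (count a g₁ r₁ g₂ r₂ g₃ r₃ g₄ t) (≡-sym e)
      where
      count : ∀ a g₁ r₁ g₂ r₂ g₃ r₃ g₄ t →
              suc t + (suc a + (suc r₃ + (suc r₂ + (suc r₁ + 0)))) + (g₁ + (g₂ + (g₃ + (g₄ + 0))))
              ≡ a + suc g₁ + r₁ + suc g₂ + r₂ + suc g₃ + r₃ + suc g₄ + suc t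
      count = solve-∀

  -- The cycle
  --   y … a, b … top, 0 … y', x' … b', a' … x, back to y
  -- again misses only a…a', x…x', b'…b and y'…y.
  nestedPairsWrapped : ∀ y' y a a' x x' b' b →
                       y' < y → y ≤ a → a < a' → a' ≤ x → x < x' → x' ≤ b' → b' < b → b < n →
                       E a b → E a' b' → ChordAt x y → E x' y' →
                       Σ ℕ λ g → Good g × g ≤ sum (a' ∸ a ∷ x' ∸ x ∷ b ∸ b' ∷ y ∸ y' ∷ [])
  nestedPairsWrapped y' y a a' x x' b' b y'<y y≤a a<a' a'≤x x<x' x'≤b' b'<b b<n eab ea'b' chord ex'y'
    with <-split y'<y | ≤-split y≤a | <-split a<a' | ≤-split a'≤x | <-split x<x' | ≤-split x'≤b' | <-split b'<b | <-split b<n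
  ... | g₄ , refl | r₀ , refl | g₁ , refl | r₁ , refl | g₂ , refl | r₂ , refl | g₃ , refl | t , e =
    g₁ + (g₂ + (g₃ + (g₄ + 0))) , goodOfRuns R₁ (R₂ ∷ R₃ ∷ R₄ ∷ R₅ ∷ []) inRange aparts links (three≤totalSize R₁ R₂ R₃ (R₄ ∷ R₅ ∷ [])) chord sizes
                      , +-mono-≤ (gap≤ a g₁) (+-mono-≤ (gap≤ x g₂) (+-mono-≤ (gap≤ b' g₃) (+-mono-≤ (gap≤ y' g₄) ≤-refl)))
    where
    R₁ R₂ R₃ R₄ R₅ : Run
    R₁ = run up y r₀
    R₂ = run up b t
    R₃ = run up 0 y'
    R₄ = run up x' r₂
    R₅ = run up a' r₁
    x<b : x < b
    x<b = <-≤-trans (<+suc x g₂) (≤-trans (m≤m+n x' r₂) (<⇒≤ (<+suc b' g₃)))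
    a<x : a < x
    a<x = <-≤-trans (<+suc a g₁) (m≤m+n a' r₁)
    y'<a : y' < a
    y'<a = <-≤-trans (<+suc y' g₄) (m≤m+n y r₀)
    inRange : All InRange (R₁ ∷ R₂ ∷ R₃ ∷ R₄ ∷ R₅ ∷ [])
    inRange = <-trans (<-trans a<x x<b) b<n ∷ toTop b t e ∷ <-trans (<-trans y'<a (<-trans a<x x<b)) b<n
            ∷ <-trans (<+suc b' g₃) b<n ∷ <-trans x<b b<n ∷ []
    aparts : AllPairs Apart (R₁ ∷ R₂ ∷ R₃ ∷ R₄ ∷ R₅ ∷ [])
    aparts = (inj₁ (<-trans a<x x<b) ∷ inj₂ (<+suc y' g₄) ∷ inj₁ (<-trans a<x (<+suc x g₂)) ∷ inj₁ (<+suc a g₁) ∷ [])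
           ∷ (inj₂ (<-trans y'<a (<-trans a<x x<b)) ∷ inj₂ (<+suc b' g₃) ∷ inj₂ x<b ∷ [])
           ∷ (inj₁ (<-trans y'<a (<-trans a<x (<+suc x g₂))) ∷ inj₁ (<-trans y'<a (<+suc a g₁)) ∷ [])
           ∷ (inj₂ (<+suc x g₂) ∷ [])
           ∷ [] ∷ []
    links : Linked R₁ (R₂ ∷ R₃ ∷ R₄ ∷ R₅ ∷ [])
    links = eab , subst (λ z → E z 0) (lastPos≡ b t e) E-wrap , E-sym ex'y' , E-sym ea'b' , tt
    sizes : totalSize (R₁ ∷ R₂ ∷ R₃ ∷ R₄ ∷ R₅ ∷ []) + (g₁ + (g₂ + (g₃ + (g₄ + 0)))) ≡ n
    sizes = trans (count y' g₄ r₀ g₁ r₁ g₂ r₂ g₃ t) (≡-sym e)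
      where
      count : ∀ y' g₄ r₀ g₁ r₁ g₂ r₂ g₃ t →
              suc r₀ + (suc t + (suc y' + (suc r₂ + (suc r₁ + 0)))) + (g₁ + (g₂ + (g₃ + (g₄ + 0))))
              ≡ y' + suc g₄ + r₀ + suc g₁ + r₁ + suc g₂ + r₂ + suc g₃ + suc t
      count = solve-∀

module ChordPositions {n : ℕ} {G : Graph n} (C : HamCycle G) where
  open Positions C

  record ChordPos : Set where
    constructor chordPos
    field
      lo hi : ℕ
      lo<hi : lo < hi
      hi<n  : hi < n
      isChord : ChordAt lo hi

  open ChordPos public

  Ends : ChordPos → ℕ → ℕ → Set
  Ends c x y = (lo c ≡ x × hi c ≡ y) ⊎ (lo c ≡ y × hi c ≡ x)

  sortChord : (u v : Fin n) → Chord C u v → u ≢ v → Σ ChordPos λ c → Ends c (pos u) (pos v)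
  sortChord u v (e , ¬c) u≢v with <-cmp (pos u) (pos v)
  ... | tri< lt _ _ = chordPos (pos u) (pos v) lt (pos<n v) (E-of e , ¬CE-of ¬c) , inj₁ (refl , refl)
  ... | tri≈ _ eq _ = ⊥-elim (u≢v (pos-injective eq))
  ... | tri> _ _ gt = chordPos (pos v) (pos u) gt (pos<n u) (ChordAt-sym (E-of e , ¬CE-of ¬c)) , inj₂ (refl , refl)

  Btw : ℕ → ℕ → ℕ → Set
  Btw x y p = (x < p × p < y) ⊎ (y < p × p < x)

  Inside : ChordPos → ℕ → Set
  Inside c p = lo c < p × p < hi c

  btw⇒inside : ∀ c {x y p} → Ends c x y → Btw x y p → Inside c p
  btw⇒inside c (inj₁ (refl , refl)) (inj₁ h) = h
  btw⇒inside c (inj₁ (refl , refl)) (inj₂ (a , b)) = ⊥-elim (<-asym (lo<hi c) (<-trans a b))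
  btw⇒inside c (inj₂ (refl , refl)) (inj₁ (a , b)) = ⊥-elim (<-asym (lo<hi c) (<-trans a b))
  btw⇒inside c (inj₂ (refl , refl)) (inj₂ h) = h

  inside⇒btw : ∀ c {x y p} → Ends c x y → Inside c p → Btw x y p
  inside⇒btw c (inj₁ (refl , refl)) h = inj₁ h
  inside⇒btw c (inj₂ (refl , refl)) h = inj₂ h

  lo-end : ∀ c {x y} → Ends c x y → lo c ≡ x ⊎ lo c ≡ y
  lo-end c (inj₁ (e , _)) = inj₁ e
  lo-end c (inj₂ (e , _)) = inj₂ e

  hi-end : ∀ c {x y} → Ends c x y → hi c ≡ x ⊎ hi c ≡ y
  hi-end c (inj₁ (_ , e)) = inj₂ e
  hi-end c (inj₂ (_ , e)) = inj₁ e

  OneInside : ChordPos → ℕ → ℕ → Set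
  OneInside c p q = (Inside c p × ¬ Inside c q) ⊎ (¬ Inside c p × Inside c q)

  oneInside : ∀ c₀ c₁ {x₀ y₀ x₁ y₁} → Ends c₀ x₀ y₀ → Ends c₁ x₁ y₁ →
              ((Btw x₀ y₀ x₁ × ¬ Btw x₀ y₀ y₁) ⊎ (¬ Btw x₀ y₀ x₁ × Btw x₀ y₀ y₁)) →
              OneInside c₀ (lo c₁) (hi c₁)
  oneInside c₀ c₁ e₀ (inj₁ (refl , refl)) (inj₁ (b , ¬b)) = inj₁ (btw⇒inside c₀ e₀ b , λ i → ¬b (inside⇒btw c₀ e₀ i))
  oneInside c₀ c₁ e₀ (inj₁ (refl , refl)) (inj₂ (¬b , b)) = inj₂ ((λ i → ¬b (inside⇒btw c₀ e₀ i)) , btw⇒inside c₀ e₀ b)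
  oneInside c₀ c₁ e₀ (inj₂ (refl , refl)) (inj₁ (b , ¬b)) = inj₂ ((λ i → ¬b (inside⇒btw c₀ e₀ i)) , btw⇒inside c₀ e₀ b)
  oneInside c₀ c₁ e₀ (inj₂ (refl , refl)) (inj₂ (¬b , b)) = inj₁ (btw⇒inside c₀ e₀ b , λ i → ¬b (inside⇒btw c₀ e₀ i))

  Crosses : ChordPos → ChordPos → Set
  Crosses c₀ c₁ = lo c₀ < lo c₁ × lo c₁ < hi c₀ × hi c₀ < hi c₁

  crossOrder : ∀ c₀ c₁ → lo c₁ ≢ lo c₀ → hi c₁ ≢ hi c₀ → OneInside c₀ (lo c₁) (hi c₁) →
               Crosses c₀ c₁ ⊎ Crosses c₁ c₀
  crossOrder c₀ c₁ _ hi≢ (inj₁ ((l<l' , l'<h) , outside)) with <-cmp (hi c₀) (hi c₁)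
  ... | tri< h<h' _ _ = inj₁ (l<l' , l'<h , h<h')
  ... | tri≈ _ e _ = ⊥-elim (hi≢ (≡-sym e))
  ... | tri> _ _ h'<h = ⊥-elim (outside (<-trans l<l' (lo<hi c₁) , h'<h))
  crossOrder c₀ c₁ lo≢ _ (inj₂ (outside , (l<h' , h'<h))) with <-cmp (lo c₁) (lo c₀)
  ... | tri< l'<l _ _ = inj₂ (l'<l , l<h' , h'<h)
  ... | tri≈ _ e _ = ⊥-elim (lo≢ e)
  ... | tri> _ _ l<l' = ⊥-elim (outside (l<l' , <-trans (lo<hi c₁) h'<h))

  crossing : ∀ c₀ c₁ {x₀ y₀ x₁ y₁} → Ends c₀ x₀ y₀ → Ends c₁ x₁ y₁ →
             x₀ ≢ x₁ → x₀ ≢ y₁ → y₀ ≢ x₁ → y₀ ≢ y₁ →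
             ((Btw x₀ y₀ x₁ × ¬ Btw x₀ y₀ y₁) ⊎ (¬ Btw x₀ y₀ x₁ × Btw x₀ y₀ y₁)) →
             Crosses c₀ c₁ ⊎ Crosses c₁ c₀
  crossing c₀ c₁ {x₀} {y₀} {x₁} {y₁} e₀ e₁ d₁ d₂ d₃ d₄ alternate =
    crossOrder c₀ c₁ (distinct (lo-end c₁ e₁) (lo-end c₀ e₀)) (distinct (hi-end c₁ e₁) (hi-end c₀ e₀))
               (oneInside c₀ c₁ e₀ e₁ alternate)
    where
    distinct : ∀ {p q} → p ≡ x₁ ⊎ p ≡ y₁ → q ≡ x₀ ⊎ q ≡ y₀ → p ≢ q
    distinct (inj₁ refl) (inj₁ refl) e = d₁ (≡-sym e)
    distinct (inj₁ refl) (inj₂ refl) e = d₃ (≡-sym e)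
    distinct (inj₂ refl) (inj₁ refl) e = d₂ (≡-sym e)
    distinct (inj₂ refl) (inj₂ refl) e = d₄ (≡-sym e)

  record Crossing : Set where
    field
      a c b d : ℕ
      a<c     : a < c
      c<b     : c < b
      b<d     : b < d
      d<n     : d < n
      ab      : ChordAt a b
      cd      : ChordAt c d

    a<b : a < b
    a<b = <-trans a<c c<b

    b<n : b < n
    b<n = <-trans b<d d<n

    c<d : c < d
    c<d = <-trans c<b b<d

  record Apart₄ (p q : Crossing) : Set where
    constructor apart₄
    field
      a≢ : Crossing.a p ≢ Crossing.a q
      c≢ : Crossing.c p ≢ Crossing.c q
      b≢ : Crossing.b p ≢ Crossing.b q
      d≢ : Crossing.d p ≢ Crossing.d q

  open Apart₄ public

  Apart₄-sym : ∀ {p q} → Apart₄ p q → Apart₄ q p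
  Apart₄-sym (apart₄ h₁ h₂ h₃ h₄) = apart₄ (λ e → h₁ (≡-sym e)) (λ e → h₂ (≡-sym e)) (λ e → h₃ (≡-sym e)) (λ e → h₄ (≡-sym e))

-- Cutting the positions 0 … n-1 into k arcs of consecutive positions,
-- arc p = ⌊p k / n⌋; positions in a common arc are less than n / k apart,
-- so a cycle missing only a few within-arc stretches misses O(n / k) vertices.
module Arcs {n : ℕ} {G : Graph n} (C : HamCycle G) (k : ℕ) (k≥1 : 1 ≤ k) where
  open Positions C
  open Configurations C
  open ChordPositions C

  instance
    n-nonZero : NonZero n
    n-nonZero = >-nonZero 0<n
    k-nonZero : NonZero k
    k-nonZero = >-nonZero k≥1

  arc : ℕ → ℕ
  arc p = (p * k) / n

  arc-mono : ∀ {p q} → p ≤ q → arc p ≤ arc q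
  arc-mono le = /-monoˡ-≤ n (*-monoˡ-≤ k le)

  arc-reflects-< : ∀ {p q} → arc p < arc q → p < q
  arc-reflects-< {p} {q} lt with p <? q
  ... | yes p<q = p<q
  ... | no p≮q = ⊥-elim (<⇒≱ lt (arc-mono (≮⇒≥ p≮q)))

  arc<k : ∀ {p} → p < n → arc p < k
  arc<k {p} p<n = m<n*o⇒m/o<n (subst (p * k <_) (*-comm n k) (*-monoˡ-< k p<n))

  sameArc-close : ∀ {p q} → arc p ≡ arc q → p ≤ q → (q ∸ p) * k < n
  sameArc-close {p} {q} same p≤q =
    subst (_< n) (≡-sym (*-distribʳ-∸ k q p)) (m<n+o⇒m∸n<o (q * k) (p * k) qk<pk+n)
    where
    -- both p k and q k lie in [arc p · n, arc p · n + n)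
    pk≥ : arc p * n ≤ p * k
    pk≥ = m/n*n≤m (p * k) n
    qk< : q * k < n + arc p * n
    qk< = subst (λ z → q * k < n + z * n) (≡-sym same)
            (subst (_< n + arc q * n) (≡-sym (m≡m%n+[m/n]*n (q * k) n)) (+-monoˡ-< (arc q * n) (m%n<n (q * k) n)))
    qk<pk+n : q * k < p * k + n
    qk<pk+n = <-≤-trans qk< (subst (_≤ p * k + n) (+-comm (arc p * n) n) (+-monoˡ-≤ n pk≥))

  Short : Set
  Short = Σ ℕ λ g → Good g × g * k ≤ 4 * n

  WithinArc : ℕ → Set
  WithinArc A = A * k < n

  sum-withinArc : ∀ As → All WithinArc As → sum As * k ≤ length As * n
  sum-withinArc [] [] = z≤n
  sum-withinArc (A ∷ As) (A< ∷ As<) = begin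
    (A + sum As) * k       ≡⟨ *-distribʳ-+ k A (sum As) ⟩
    A * k + sum As * k     ≤⟨ +-mono-≤ (<⇒≤ A<) (sum-withinArc As As<) ⟩
    n + length As * n      ∎
    where open ≤-Reasoning

  short : ∀ As → (Σ ℕ λ g → Good g × g ≤ sum As) → All WithinArc As → length As ≤ 4 → Short
  short As (g , good , g≤) within ≤4 =
    g , good , ≤-trans (*-monoˡ-≤ k g≤) (≤-trans (sum-withinArc As within) (*-monoˡ-≤ n ≤4))

  short-oneChord : ∀ lo hi → lo < hi → hi < n → ChordAt lo hi → arc lo ≡ arc hi → Short
  short-oneChord lo hi lo<hi hi<n chord same =
    short (hi ∸ lo ∷ []) (oneChord lo hi lo<hi hi<n chord) (sameArc-close same (<⇒≤ lo<hi) ∷ []) (s≤s z≤n)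

  short-crossing : ∀ x p' q q' → x < p' → p' < q → q < q' → q' < n → E x q → ChordAt p' q' →
                   arc x ≡ arc p' → arc q ≡ arc q' → Short
  short-crossing x p' q q' x<p' p'<q q<q' q'<n exq chord same₁ same₂ =
    short (p' ∸ x ∷ q' ∸ q ∷ []) (crossingPair x p' q q' x<p' p'<q q<q' q'<n exq chord)
          (sameArc-close same₁ (<⇒≤ x<p') ∷ sameArc-close same₂ (<⇒≤ q<q') ∷ []) (s≤s (s≤s z≤n))

  short-nested : ∀ a a' x x' b' b y' y →
                 a < a' → a' ≤ x → x < x' → x' ≤ b' → b' < b → b ≤ y' → y' < y → y < n →
                 E a b → E a' b' → ChordAt x y → E x' y' →
                 arc a ≡ arc a' → arc x ≡ arc x' → arc b' ≡ arc b → arc y' ≡ arc y → Short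
  short-nested a a' x x' b' b y' y a<a' a'≤x x<x' x'≤b' b'<b b≤y' y'<y y<n eab ea'b' chord ex'y' s₁ s₂ s₃ s₄ =
    short (a' ∸ a ∷ x' ∸ x ∷ b ∸ b' ∷ y ∸ y' ∷ [])
          (nestedPairs a a' x x' b' b y' y a<a' a'≤x x<x' x'≤b' b'<b b≤y' y'<y y<n eab ea'b' chord ex'y')
          (sameArc-close s₁ (<⇒≤ a<a') ∷ sameArc-close s₂ (<⇒≤ x<x') ∷ sameArc-close s₃ (<⇒≤ b'<b)
           ∷ sameArc-close s₄ (<⇒≤ y'<y) ∷ []) ≤-refl

  short-nestedWrapped : ∀ y' y a a' x x' b' b →
                        y' < y → y ≤ a → a < a' → a' ≤ x → x < x' → x' ≤ b' → b' < b → b < n →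
                        E a b → E a' b' → ChordAt x y → E x' y' →
                        arc a ≡ arc a' → arc x ≡ arc x' → arc b' ≡ arc b → arc y' ≡ arc y → Short
  short-nestedWrapped y' y a a' x x' b' b y'<y y≤a a<a' a'≤x x<x' x'≤b' b'<b b<n eab ea'b' chord ex'y' s₁ s₂ s₃ s₄ =
    short (a' ∸ a ∷ x' ∸ x ∷ b ∸ b' ∷ y ∸ y' ∷ [])
          (nestedPairsWrapped y' y a a' x x' b' b y'<y y≤a a<a' a'≤x x<x' x'≤b' b'<b b<n eab ea'b' chord ex'y')
          (sameArc-close s₁ (<⇒≤ a<a') ∷ sameArc-close s₂ (<⇒≤ x<x') ∷ sameArc-close s₃ (<⇒≤ b'<b)
           ∷ sameArc-close s₄ (<⇒≤ y'<y) ∷ []) ≤-refl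

  sameBox : ∀ p q p' q' → p < q → p' < q' → q < n → q' < n → p ≢ p' → q ≢ q' →
            arc p ≡ arc p' → arc q ≡ arc q' → arc p < arc q → ChordAt p q → ChordAt p' q' →
            Short ⊎ ((p < p' × q' < q) ⊎ (p' < p × q < q'))
  sameBox p q p' q' p<q p'<q' q<n q'<n p≢p' q≢q' sp sq apq pq p'q' with <-cmp p p' | <-cmp q q'
  ... | tri≈ _ e _ | _ = ⊥-elim (p≢p' e)
  ... | _ | tri≈ _ e _ = ⊥-elim (q≢q' e)
  ... | tri< pp _ _ | tri< qq _ _ =
    inj₁ (short-crossing p p' q q' pp (arc-reflects-< (subst (_< arc q) sp apq)) qq q'<n (proj₁ pq) p'q' sp sq)
  ... | tri< pp _ _ | tri> _ _ qq = inj₂ (inj₁ (pp , qq))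
  ... | tri> _ _ pp | tri> _ _ qq =
    inj₁ (short-crossing p' p q' q pp (arc-reflects-< (subst (arc p <_) sq apq)) qq q<n (proj₁ p'q') pq (≡-sym sp) (≡-sym sq))
  ... | tri> _ _ pp | tri< qq _ _ = inj₂ (inj₂ (pp , qq))

  nestedWithRightPair : ∀ a a' b' b c d c' d' → a < a' → b' < b → a' < c → a' < c' → c < b' → c' < b' →
                        b < d → b < d' → d < n → d' < n → c ≢ c' → d ≢ d' →
                        arc a ≡ arc a' → arc b' ≡ arc b → arc c ≡ arc c' → arc d ≡ arc d' →
                        E a b → E a' b' → ChordAt c d → ChordAt c' d' → Short
  nestedWithRightPair a a' b' b c d c' d' aa bb a'c a'c' cb' c'b' bd bd' dn d'n c≢c' d≢d' sa sb sc sd ab a'b' cd c'd'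
    with <-cmp c c' | <-cmp d d'
  ... | tri≈ _ e _ | _ = ⊥-elim (c≢c' e)
  ... | _ | tri≈ _ e _ = ⊥-elim (d≢d' e)
  ... | tri< cc _ _ | tri< dd _ _ =
    short-crossing c c' d d' cc (<-trans c'b' (<-trans bb bd)) dd d'n (proj₁ cd) c'd' sc sd
  ... | tri< cc _ _ | tri> _ _ dd =
    short-nested a a' c c' b' b d' d aa (<⇒≤ a'c) cc (<⇒≤ c'b') bb (<⇒≤ bd') dd dn ab a'b' cd (proj₁ c'd') sa sc sb (≡-sym sd)
  ... | tri> _ _ cc | tri> _ _ dd =
    short-crossing c' c d' d cc (<-trans cb' (<-trans bb bd')) dd dn (proj₁ c'd') cd (≡-sym sc) (≡-sym sd)
  ... | tri> _ _ cc | tri< dd _ _ =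
    short-nested a a' c' c b' b d d' aa (<⇒≤ a'c') cc (<⇒≤ cb') bb (<⇒≤ bd) dd d'n ab a'b' c'd' (proj₁ cd) sa (≡-sym sc) sb sd

  nestedWithLeftPair : ∀ c d c' d' a b a₂ b₂ → c < c' → d' < d → c' < b → c' < b₂ → b < d' → b₂ < d' →
                       a < c → a₂ < c → d < n → a ≢ a₂ → b ≢ b₂ →
                       arc c ≡ arc c' → arc d' ≡ arc d → arc a ≡ arc a₂ → arc b ≡ arc b₂ →
                       E c d → E c' d' → ChordAt a b → ChordAt a₂ b₂ → Short
  nestedWithLeftPair c d c' d' a b a₂ b₂ cc dd c'b c'b₂ bd' b₂d' ac a₂c dn a≢a₂ b≢b₂ sc sd sa sb cd c'd' ab a₂b₂
    with <-cmp b b₂ | <-cmp a a₂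
  ... | tri≈ _ e _ | _ = ⊥-elim (b≢b₂ e)
  ... | _ | tri≈ _ e _ = ⊥-elim (a≢a₂ e)
  ... | tri< bb _ _ | tri< aa _ _ =
    short-crossing a a₂ b b₂ aa (<-trans a₂c (<-trans cc c'b)) bb (<-trans b₂d' (<-trans dd dn)) (proj₁ ab) a₂b₂ sa sb
  ... | tri< bb _ _ | tri> _ _ aa =
    short-nestedWrapped a₂ a c c' b b₂ d' d aa (<⇒≤ ac) cc (<⇒≤ c'b) bb (<⇒≤ b₂d') dd dn
                        cd c'd' (ChordAt-sym ab) (E-sym (proj₁ a₂b₂)) sc sb sd (≡-sym sa)
  ... | tri> _ _ bb | tri> _ _ aa =
    short-crossing a₂ a b₂ b aa (<-trans ac (<-trans cc c'b₂)) bb (<-trans bd' (<-trans dd dn)) (proj₁ a₂b₂) ab (≡-sym sa) (≡-sym sb)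
  ... | tri> _ _ bb | tri< aa _ _ =
    short-nestedWrapped a a₂ c c' b₂ b d' d aa (<⇒≤ a₂c) cc (<⇒≤ c'b₂) bb (<⇒≤ bd') dd dn
                        cd c'd' (ChordAt-sym a₂b₂) (E-sym (proj₁ ab)) sc (≡-sym sb) sd sa

  <-viaArc : ∀ p q {u v} → arc p ≡ u → arc q ≡ v → u < v → p < q
  <-viaArc _ _ e₁ e₂ lt = arc-reflects-< (subst₂ _<_ (≡-sym e₁) (≡-sym e₂) lt)

  ≡-viaArc : ∀ p q {u} → arc p ≡ u → arc q ≡ u → arc p ≡ arc q
  ≡-viaArc _ _ e₁ e₂ = trans e₁ (≡-sym e₂)

  ShapeAC : ℕ → ℕ → ℕ → Crossing → Set
  ShapeAC α β δ p = arc (Crossing.a p) ≡ α × arc (Crossing.c p) ≡ α × arc (Crossing.b p) ≡ β × arc (Crossing.d p) ≡ δ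

  ShapeCB : ℕ → ℕ → ℕ → Crossing → Set
  ShapeCB α μ δ p = arc (Crossing.a p) ≡ α × arc (Crossing.c p) ≡ μ × arc (Crossing.b p) ≡ μ × arc (Crossing.d p) ≡ δ

  ShapeBD : ℕ → ℕ → ℕ → Crossing → Set
  ShapeBD α γ β p = arc (Crossing.a p) ≡ α × arc (Crossing.c p) ≡ γ × arc (Crossing.b p) ≡ β × arc (Crossing.d p) ≡ β

  -- a p < a q < a r: the chords a–b of p and q are nested, and c–d of q
  -- and r leave their inside to the right
  threeOfShapeAC : ∀ α β δ → α < β → β < δ → (x y z : Crossing) →
                   ShapeAC α β δ x → ShapeAC α β δ y → ShapeAC α β δ z →
                   Apart₄ x y → Apart₄ y z → Apart₄ x z → Short
  threeOfShapeAC α β δ α<β β<δ x y z sx sy sz dxy dyz dxz =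
    sortThree Apart₄ Apart₄-sym (ShapeAC α β δ) Crossing.a x y z sx sy sz dxy dyz dxz (a≢ dxy) (a≢ dyz) (a≢ dxz) sorted
    where
    open Crossing
    sorted : ∀ p q r → ShapeAC α β δ p → ShapeAC α β δ q → ShapeAC α β δ r → Apart₄ p q → Apart₄ q r → Apart₄ p r →
             a p < a q → a q < a r → Short
    sorted p q r (pa , pc , pb , pd) (qa , qc , qb , qd) (ra , rc , rb , rd) dpq dqr _ l₁ l₂
      with sameBox (a p) (b p) (a q) (b q) (a<b p) (a<b q) (b<n p) (b<n q) (a≢ dpq) (b≢ dpq)
                   (≡-viaArc (a p) (a q) pa qa) (≡-viaArc (b p) (b q) pb qb) (subst₂ _<_ (≡-sym pa) (≡-sym pb) α<β) (ab p) (ab q)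
    ... | inj₁ found = found
    ... | inj₂ (inj₂ (l , _)) = ⊥-elim (<-asym l₁ l)
    ... | inj₂ (inj₁ (_ , b<)) =
      nestedWithRightPair (a p) (a q) (b q) (b p) (c q) (d q) (c r) (d r)
        l₁ b< (a<c q) (<-trans l₂ (a<c r)) (c<b q) (<-viaArc (c r) (b q) rc qb α<β)
        (<-viaArc (b p) (d q) pb qd β<δ) (<-viaArc (b p) (d r) pb rd β<δ) (d<n q) (d<n r) (c≢ dqr) (d≢ dqr)
        (≡-viaArc (a p) (a q) pa qa) (≡-viaArc (b q) (b p) qb pb) (≡-viaArc (c q) (c r) qc rc) (≡-viaArc (d q) (d r) qd rd)
        (proj₁ (ab p)) (proj₁ (ab q)) (cd q) (cd r)

  -- b p < b q < b r: a–b of r and q are nested, c–d of q and p leave to the right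
  threeOfShapeCB : ∀ α μ δ → α < μ → μ < δ → (x y z : Crossing) →
                   ShapeCB α μ δ x → ShapeCB α μ δ y → ShapeCB α μ δ z →
                   Apart₄ x y → Apart₄ y z → Apart₄ x z → Short
  threeOfShapeCB α μ δ α<μ μ<δ x y z sx sy sz dxy dyz dxz =
    sortThree Apart₄ Apart₄-sym (ShapeCB α μ δ) Crossing.b x y z sx sy sz dxy dyz dxz (b≢ dxy) (b≢ dyz) (b≢ dxz) sorted
    where
    open Crossing
    sorted : ∀ p q r → ShapeCB α μ δ p → ShapeCB α μ δ q → ShapeCB α μ δ r → Apart₄ p q → Apart₄ q r → Apart₄ p r →
             b p < b q → b q < b r → Short
    sorted p q r (pa , pc , pb , pd) (qa , qc , qb , qd) (ra , rc , rb , rd) dpq dqr _ l₁ l₂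
      with sameBox (a r) (b r) (a q) (b q) (a<b r) (a<b q) (b<n r) (b<n q) (λ e → a≢ dqr (≡-sym e)) (λ e → b≢ dqr (≡-sym e))
                   (≡-viaArc (a r) (a q) ra qa) (≡-viaArc (b r) (b q) rb qb) (subst₂ _<_ (≡-sym ra) (≡-sym rb) α<μ) (ab r) (ab q)
    ... | inj₁ found = found
    ... | inj₂ (inj₂ (_ , l)) = ⊥-elim (<-asym l₂ l)
    ... | inj₂ (inj₁ (a< , _)) =
      nestedWithRightPair (a r) (a q) (b q) (b r) (c q) (d q) (c p) (d p)
        a< l₂ (a<c q) (<-viaArc (a q) (c p) qa pc α<μ) (c<b q) (<-trans (c<b p) l₁)
        (<-viaArc (b r) (d q) rb qd μ<δ) (<-viaArc (b r) (d p) rb pd μ<δ) (d<n q) (d<n p)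
        (λ e → c≢ dpq (≡-sym e)) (λ e → d≢ dpq (≡-sym e))
        (≡-viaArc (a r) (a q) ra qa) (≡-viaArc (b q) (b r) qb rb) (≡-viaArc (c q) (c p) qc pc) (≡-viaArc (d q) (d p) qd pd)
        (proj₁ (ab r)) (proj₁ (ab q)) (cd q) (cd p)

  -- d p < d q < d r: c–d of r and q are nested, a–b of q and p enter from the left
  threeOfShapeBD : ∀ α γ β → α < γ → γ < β → (x y z : Crossing) →
                   ShapeBD α γ β x → ShapeBD α γ β y → ShapeBD α γ β z →
                   Apart₄ x y → Apart₄ y z → Apart₄ x z → Short
  threeOfShapeBD α γ β α<γ γ<β x y z sx sy sz dxy dyz dxz =
    sortThree Apart₄ Apart₄-sym (ShapeBD α γ β) Crossing.d x y z sx sy sz dxy dyz dxz (d≢ dxy) (d≢ dyz) (d≢ dxz) sorted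
    where
    open Crossing
    sorted : ∀ p q r → ShapeBD α γ β p → ShapeBD α γ β q → ShapeBD α γ β r → Apart₄ p q → Apart₄ q r → Apart₄ p r →
             d p < d q → d q < d r → Short
    sorted p q r (pa , pc , pb , pd) (qa , qc , qb , qd) (ra , rc , rb , rd) dpq dqr _ l₁ l₂
      with sameBox (c r) (d r) (c q) (d q) (c<d r) (c<d q) (d<n r) (d<n q) (λ e → c≢ dqr (≡-sym e)) (λ e → d≢ dqr (≡-sym e))
                   (≡-viaArc (c r) (c q) rc qc) (≡-viaArc (d r) (d q) rd qd) (subst₂ _<_ (≡-sym rc) (≡-sym rd) γ<β) (cd r) (cd q)
    ... | inj₁ found = found
    ... | inj₂ (inj₂ (_ , l)) = ⊥-elim (<-asym l₂ l)
    ... | inj₂ (inj₁ (c< , _)) =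
      nestedWithLeftPair (c r) (d r) (c q) (d q) (a q) (b q) (a p) (b p)
        c< l₂ (c<b q) (<-viaArc (c q) (b p) qc pb γ<β) (b<d q) (<-trans (b<d p) l₁)
        (<-viaArc (a q) (c r) qa rc α<γ) (<-viaArc (a p) (c r) pa rc α<γ) (d<n r)
        (λ e → a≢ dpq (≡-sym e)) (λ e → b≢ dpq (≡-sym e))
        (≡-viaArc (c r) (c q) rc qc) (≡-viaArc (d q) (d r) qd rd) (≡-viaArc (a q) (a p) qa pa) (≡-viaArc (b q) (b p) qb pb)
        (proj₁ (cd r)) (proj₁ (cd q)) (ab q) (ab p)

  -- A pair with its four ends in four different arcs, where both of its
  -- chords have box-mates g (of a–b) and h (of c–d): a–b and g are nested
  -- (or cross), and c–d, h leave their inside to the right.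
  bothBoxesThick : (p : Crossing) (g h : ChordPos) → let open Crossing p in
                   arc a < arc c → arc c < arc b → arc b < arc d →
                   a ≢ lo g → b ≢ hi g → c ≢ lo h → d ≢ hi h →
                   arc (lo g) ≡ arc a → arc (hi g) ≡ arc b → arc (lo h) ≡ arc c → arc (hi h) ≡ arc d → Short
  bothBoxesThick p g h A<C C<B B<D a≢ b≢ c≢ d≢ g₁ g₂ h₁ h₂
    with sameBox a b (lo g) (hi g) a<b (lo<hi g) b<n (hi<n g) a≢ b≢
                 (≡-sym g₁) (≡-sym g₂) (<-trans A<C C<B) ab (isChord g)
    where open Crossing p
  ... | inj₁ found = found
  ... | inj₂ (inj₁ (a<lg , hg<b)) =
    nestedWithRightPair a (lo g) (hi g) b c d (lo h) (hi h) a<lg hg<b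
      (<-viaArc (lo g) c g₁ refl A<C) (<-viaArc (lo g) (lo h) g₁ h₁ A<C)
      (<-viaArc c (hi g) refl g₂ C<B) (<-viaArc (lo h) (hi g) h₁ g₂ C<B)
      b<d (<-viaArc b (hi h) refl h₂ B<D) d<n (hi<n h) c≢ d≢
      (≡-sym g₁) g₂ (≡-sym h₁) (≡-sym h₂)
      (proj₁ ab) (proj₁ (isChord g)) cd (isChord h)
    where open Crossing p
  ... | inj₂ (inj₂ (lg<a , b<hg)) =
    nestedWithRightPair (lo g) a b (hi g) c d (lo h) (hi h) lg<a b<hg
      a<c (<-viaArc a (lo h) refl h₁ A<C)
      c<b (<-viaArc (lo h) b h₁ refl C<B)
      (<-viaArc (hi g) d g₂ refl B<D) (<-viaArc (hi g) (hi h) g₂ h₂ B<D) d<n (hi<n h) c≢ d≢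
      g₁ (≡-sym g₂) (≡-sym h₁) (≡-sym h₂)
      (proj₁ (isChord g)) (proj₁ ab) cd (isChord h)
    where open Crossing p

module PairsOf {n : ℕ} {G : Graph n} (C : HamCycle G) {m : ℕ} (I : InterlacedPairs C m) where
  open Positions C
  open ChordPositions C
  open InterlacedPairs I

  ends-differ : ∀ i s → ends i s false ≢ ends i s true
  ends-differ i s e with ends-inj i s false i s true e
  ... | _ , _ , ()

  chordOf : Fin m → Bool → ChordPos
  chordOf i s = proj₁ (sortChord (ends i s false) (ends i s true) (chord i s) (ends-differ i s))

  chordOf-ends : ∀ i s → Ends (chordOf i s) (pos (ends i s false)) (pos (ends i s true))
  chordOf-ends i s = proj₂ (sortChord (ends i s false) (ends i s true) (chord i s) (ends-differ i s))

  EndOf : Fin m → Bool → ℕ → Set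
  EndOf i s x = Σ Bool λ t → x ≡ pos (ends i s t)

  lo-endOf : ∀ i s → EndOf i s (lo (chordOf i s))
  lo-endOf i s with lo-end (chordOf i s) (chordOf-ends i s)
  ... | inj₁ e = false , e
  ... | inj₂ e = true , e

  hi-endOf : ∀ i s → EndOf i s (hi (chordOf i s))
  hi-endOf i s with hi-end (chordOf i s) (chordOf-ends i s)
  ... | inj₁ e = false , e
  ... | inj₂ e = true , e

  -- by independence, a position is an end of at most one chord of I
  endOf-unique : ∀ {i s j s' x} → EndOf i s x → EndOf j s' x → (i ≡ j) × (s ≡ s')
  endOf-unique {i} {s} {j} {s'} (t , e) (t' , e') with ends-inj i s t j s' t' (pos-injective (trans (≡-sym e) e'))
  ... | i≡j , s≡s' , _ = i≡j , s≡s'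

  record SortedPair (i : Fin m) : Set where
    field
      σ    : Bool
      pair : Crossing
      a≡   : Crossing.a pair ≡ lo (chordOf i σ)
      b≡   : Crossing.b pair ≡ hi (chordOf i σ)
      c≡   : Crossing.c pair ≡ lo (chordOf i (not σ))
      d≡   : Crossing.d pair ≡ hi (chordOf i (not σ))

  sortedAs : ∀ i τ → Crosses (chordOf i τ) (chordOf i (not τ)) → SortedPair i
  sortedAs i τ (l₁ , l₂ , l₃) = record
    { σ = τ
    ; pair = record { a = lo c₀ ; c = lo c₁ ; b = hi c₀ ; d = hi c₁ ; a<c = l₁ ; c<b = l₂ ; b<d = l₃
                    ; d<n = hi<n c₁ ; ab = isChord c₀ ; cd = isChord c₁ }
    ; a≡ = refl ; b≡ = refl ; c≡ = refl ; d≡ = refl }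
    where
    c₀ c₁ : ChordPos
    c₀ = chordOf i τ
    c₁ = chordOf i (not τ)

  sortPair : ∀ i → SortedPair i
  sortPair i with interlace i
  ... | (_ , u≢x , u≢y , v≢x , v≢y , _) , alternate
    with crossing (chordOf i false) (chordOf i true) (chordOf-ends i false) (chordOf-ends i true)
                  (λ e → u≢x (pos-injective e)) (λ e → u≢y (pos-injective e))
                  (λ e → v≢x (pos-injective e)) (λ e → v≢y (pos-injective e)) alternate
  ... | inj₁ crosses = sortedAs i false crosses
  ... | inj₂ crosses = sortedAs i true crosses

  σ : Fin m → Bool
  σ i = SortedPair.σ (sortPair i)

  pairAt : Fin m → Crossing
  pairAt i = SortedPair.pair (sortPair i)

  endA : ∀ i → EndOf i (σ i) (Crossing.a (pairAt i))
  endA i = subst (EndOf i (σ i)) (≡-sym (SortedPair.a≡ (sortPair i))) (lo-endOf i (σ i))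
  endB : ∀ i → EndOf i (σ i) (Crossing.b (pairAt i))
  endB i = subst (EndOf i (σ i)) (≡-sym (SortedPair.b≡ (sortPair i))) (hi-endOf i (σ i))
  endC : ∀ i → EndOf i (not (σ i)) (Crossing.c (pairAt i))
  endC i = subst (EndOf i (not (σ i))) (≡-sym (SortedPair.c≡ (sortPair i))) (lo-endOf i (not (σ i)))
  endD : ∀ i → EndOf i (not (σ i)) (Crossing.d (pairAt i))
  endD i = subst (EndOf i (not (σ i))) (≡-sym (SortedPair.d≡ (sortPair i))) (hi-endOf i (not (σ i)))

  pairs-apart : ∀ {i j} → i ≢ j → Apart₄ (pairAt i) (pairAt j)
  pairs-apart {i} {j} i≢j =
    apart₄ (λ e → i≢j (proj₁ (endOf-unique (endA i) (subst (EndOf j (σ j)) (≡-sym e) (endA j)))))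
           (λ e → i≢j (proj₁ (endOf-unique (endC i) (subst (EndOf j (not (σ j))) (≡-sym e) (endC j)))))
           (λ e → i≢j (proj₁ (endOf-unique (endB i) (subst (EndOf j (σ j)) (≡-sym e) (endB j)))))
           (λ e → i≢j (proj₁ (endOf-unique (endD i) (subst (EndOf j (not (σ j))) (≡-sym e) (endD j)))))

-- Each interlacing pair of I either yields a short cycle directly, or is
-- assigned a class: one of five tags and three arcs (< k).  Pairs sharing a
-- class are compatible in a way that turns two (tags thinAB/thinCD, which is
-- impossible) or three (the shape tags) of them into a short cycle.
data Tag : Set where
  thinAB thinCD shapeAC shapeCB shapeBD : Tag

tagIndex : Tag → Fin 5
tagIndex thinAB = Fin.zero
tagIndex thinCD = Fin.suc Fin.zero
tagIndex shapeAC = Fin.suc (Fin.suc Fin.zero)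
tagIndex shapeCB = Fin.suc (Fin.suc (Fin.suc Fin.zero))
tagIndex shapeBD = Fin.suc (Fin.suc (Fin.suc (Fin.suc Fin.zero)))

tagIndex-injective : ∀ {s t} → tagIndex s ≡ tagIndex t → s ≡ t
tagIndex-injective {s} {t} e = trans (≡-sym (inverse s)) (trans (cong tagOf e) (inverse t))
  where
  tagOf : Fin 5 → Tag
  tagOf Fin.zero = thinAB
  tagOf (Fin.suc Fin.zero) = thinCD
  tagOf (Fin.suc (Fin.suc Fin.zero)) = shapeAC
  tagOf (Fin.suc (Fin.suc (Fin.suc Fin.zero))) = shapeCB
  tagOf (Fin.suc (Fin.suc (Fin.suc (Fin.suc _)))) = shapeBD
  inverse : ∀ t → tagOf (tagIndex t) ≡ t
  inverse thinAB = refl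
  inverse thinCD = refl
  inverse shapeAC = refl
  inverse shapeCB = refl
  inverse shapeBD = refl

module Classification {n : ℕ} {G : Graph n} (C : HamCycle G) (k : ℕ) (k≥1 : 1 ≤ k)
                      {m : ℕ} (I : InterlacedPairs C m) where
  open Positions C
  open ChordPositions C
  open Arcs C k k≥1
  open PairsOf C I

  ChordId : Set
  ChordId = Fin m × Bool

  InBox : ChordId → ℕ → ℕ → Set
  InBox (j , s) X Y = arc (lo (chordOf j s)) ≡ X × arc (hi (chordOf j s)) ≡ Y

  Thin : ChordId → ℕ → ℕ → Set
  Thin c X Y = ∀ c' → c' ≢ c → ¬ InBox c' X Y

  someChord? : {Q : ChordId → Set} → (∀ c → Dec (Q c)) → Dec (Σ ChordId Q)
  someChord? {Q} Q? with FinP.any? (λ j → Q? (j , false)) | FinP.any? (λ j → Q? (j , true))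
  ... | yes (j , q) | _ = yes ((j , false) , q)
  ... | no _ | yes (j , q) = yes ((j , true) , q)
  ... | no none₀ | no none₁ = no λ { ((j , false) , q) → none₀ (j , q) ; ((j , true) , q) → none₁ (j , q) }

  boxMate? : (c : ChordId) (X Y : ℕ) → Dec (Σ ChordId λ c' → c' ≢ c × InBox c' X Y)
  boxMate? c X Y = someChord? mate?
    where
    mate? : ∀ c' → Dec (c' ≢ c × InBox c' X Y)
    mate? c' with ≡-dec FinP._≟_ Bool._≟_ c' c
                | arc (lo (chordOf (proj₁ c') (proj₂ c'))) ℕ.≟ X | arc (hi (chordOf (proj₁ c') (proj₂ c'))) ℕ.≟ Y
    ... | yes e | _ | _ = no (λ z → proj₁ z e)
    ... | no ne | yes e₁ | yes e₂ = yes (ne , e₁ , e₂)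
    ... | no _ | no ne | _ = no (λ z → ne (proj₁ (proj₂ z)))
    ... | no _ | yes _ | no ne = no (λ z → ne (proj₂ (proj₂ z)))

  data Evidence (i : Fin m) : Tag → ℕ → ℕ → ℕ → Set where
    ev-thinAB  : ∀ {X Y Z} → InBox (i , σ i) X Y → Thin (i , σ i) X Y → Evidence i thinAB X Y Z
    ev-thinCD  : ∀ {X Y Z} → InBox (i , not (σ i)) X Y → Thin (i , not (σ i)) X Y → Evidence i thinCD X Y Z
    ev-shapeAC : ∀ {X Y Z} → X < Y → Y < Z → ShapeAC X Y Z (pairAt i) → Evidence i shapeAC X Y Z
    ev-shapeCB : ∀ {X Y Z} → X < Y → Y < Z → ShapeCB X Y Z (pairAt i) → Evidence i shapeCB X Y Z
    ev-shapeBD : ∀ {X Y Z} → X < Y → Y < Z → ShapeBD X Y Z (pairAt i) → Evidence i shapeBD X Y Z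

  Class : Fin m → Set
  Class i = Σ Tag λ t → Σ ℕ λ X → Σ ℕ λ Y → Σ ℕ λ Z → Evidence i t X Y Z × X < k × Y < k × Z < k

  chordId-≡ : ∀ {i j : Fin m} {s t : Bool} → (i ≡ j) × (s ≡ t) → (i , s) ≡ (j , t)
  chordId-≡ (refl , refl) = refl

  thickPair : ∀ i → let open Crossing (pairAt i) in
              arc a < arc c → arc c < arc b → arc b < arc d →
              (g : ChordId) → g ≢ (i , σ i) → InBox g (arc a) (arc b) →
              (h : ChordId) → h ≢ (i , not (σ i)) → InBox h (arc c) (arc d) → Short
  thickPair i A<C C<B B<D (gj , gs) g≢ (g₁ , g₂) (hj , hs) h≢ (h₁ , h₂) =
    bothBoxesThick (pairAt i) (chordOf gj gs) (chordOf hj hs) A<C C<B B<D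
      (λ e → g≢ (chordId-≡ (endOf-unique (lo-endOf gj gs) (subst (EndOf i (σ i)) e (endA i)))))
      (λ e → g≢ (chordId-≡ (endOf-unique (hi-endOf gj gs) (subst (EndOf i (σ i)) e (endB i)))))
      (λ e → h≢ (chordId-≡ (endOf-unique (lo-endOf hj hs) (subst (EndOf i (not (σ i))) e (endC i)))))
      (λ e → h≢ (chordId-≡ (endOf-unique (hi-endOf hj hs) (subst (EndOf i (not (σ i))) e (endD i)))))
      g₁ g₂ h₁ h₂

  module PairClass (i : Fin m) where
    open Crossing (pairAt i)

    A Cc B D : ℕ
    A = arc a
    Cc = arc c
    B = arc b
    D = arc d

    A≤C : A ≤ Cc
    A≤C = arc-mono (<⇒≤ a<c)
    C≤B : Cc ≤ B
    C≤B = arc-mono (<⇒≤ c<b)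
    B≤D : B ≤ D
    B≤D = arc-mono (<⇒≤ b<d)

    A<k : A < k
    A<k = arc<k (<-trans a<b b<n)
    C<k : Cc < k
    C<k = arc<k (<-trans c<b b<n)
    B<k : B < k
    B<k = arc<k b<n
    D<k : D < k
    D<k = arc<k d<n

    inBoxAB : InBox (i , σ i) A B
    inBoxAB = cong arc (≡-sym (SortedPair.a≡ (sortPair i))) , cong arc (≡-sym (SortedPair.b≡ (sortPair i)))
    inBoxCD : InBox (i , not (σ i)) Cc D
    inBoxCD = cong arc (≡-sym (SortedPair.c≡ (sortPair i))) , cong arc (≡-sym (SortedPair.d≡ (sortPair i)))

    spread : A < Cc → Cc < B → B < D → Short ⊎ Class i
    spread A<C C<B B<D with boxMate? (i , σ i) A B | boxMate? (i , not (σ i)) Cc D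
    ... | no none | _ = inj₂ (thinAB , A , B , A , ev-thinAB inBoxAB (λ c' ne ib → none (c' , ne , ib)) , A<k , B<k , A<k)
    ... | yes _ | no none = inj₂ (thinCD , Cc , D , Cc , ev-thinCD inBoxCD (λ c' ne ib → none (c' , ne , ib)) , C<k , D<k , C<k)
    ... | yes (g , g≢ , inG) | yes (h , h≢ , inH) = inj₁ (thickPair i A<C C<B B<D g g≢ inG h h≢ inH)

    pairClass : Short ⊎ Class i
    pairClass with A ℕ.≟ B | Cc ℕ.≟ D
    ... | yes A≡B | _ = inj₁ (short-oneChord a b a<b b<n ab A≡B)
    ... | no _ | yes C≡D = inj₁ (short-oneChord c d c<d d<n cd C≡D)
    ... | no A≢B | no C≢D with A ℕ.≟ Cc | Cc ℕ.≟ B | B ℕ.≟ D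
    ...   | yes A≡C | _ | yes B≡D = inj₁ (short-crossing a c b d a<c c<b b<d d<n (proj₁ ab) cd A≡C B≡D)
    ...   | yes A≡C | _ | no B≢D =
      inj₂ (shapeAC , A , B , D , ev-shapeAC (≤∧≢⇒< (≤-trans A≤C C≤B) A≢B) (≤∧≢⇒< B≤D B≢D)
                                             (refl , ≡-sym A≡C , refl , refl) , A<k , B<k , D<k)
    ...   | no A≢C | yes C≡B | _ =
      inj₂ (shapeCB , A , Cc , D , ev-shapeCB (≤∧≢⇒< A≤C A≢C) (≤∧≢⇒< (≤-trans C≤B B≤D) C≢D)
                                              (refl , refl , ≡-sym C≡B , refl) , A<k , C<k , D<k)
    ...   | no A≢C | no C≢B | yes B≡D =
      inj₂ (shapeBD , A , Cc , B , ev-shapeBD (≤∧≢⇒< A≤C A≢C) (≤∧≢⇒< C≤B C≢B)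
                                              (refl , refl , refl , ≡-sym B≡D) , A<k , C<k , B<k)
    ...   | no A≢C | no C≢B | no B≢D = spread (≤∧≢⇒< A≤C A≢C) (≤∧≢⇒< C≤B C≢B) (≤∧≢⇒< B≤D B≢D)

  open PairClass using (pairClass) public

  -- Two pairs with the same thin class would be box-mates; three pairs with
  -- the same shape class give a short cycle.
  sameClass : ∀ {t X Y Z} i j l → i ≢ j → j ≢ l → i ≢ l →
              Evidence i t X Y Z → Evidence j t X Y Z → Evidence l t X Y Z → Short
  sameClass i j l i≢j _ _ (ev-thinAB _ thin) (ev-thinAB inBox _) _ =
    ⊥-elim (thin (j , σ j) (λ e → i≢j (≡-sym (cong proj₁ e))) inBox)
  sameClass i j l i≢j _ _ (ev-thinCD _ thin) (ev-thinCD inBox _) _ =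
    ⊥-elim (thin (j , not (σ j)) (λ e → i≢j (≡-sym (cong proj₁ e))) inBox)
  sameClass i j l i≢j j≢l i≢l (ev-shapeAC X<Y Y<Z si) (ev-shapeAC _ _ sj) (ev-shapeAC _ _ sl) =
    threeOfShapeAC _ _ _ X<Y Y<Z (pairAt i) (pairAt j) (pairAt l) si sj sl (pairs-apart i≢j) (pairs-apart j≢l) (pairs-apart i≢l)
  sameClass i j l i≢j j≢l i≢l (ev-shapeCB X<Y Y<Z si) (ev-shapeCB _ _ sj) (ev-shapeCB _ _ sl) =
    threeOfShapeCB _ _ _ X<Y Y<Z (pairAt i) (pairAt j) (pairAt l) si sj sl (pairs-apart i≢j) (pairs-apart j≢l) (pairs-apart i≢l)
  sameClass i j l i≢j j≢l i≢l (ev-shapeBD X<Y Y<Z si) (ev-shapeBD _ _ sj) (ev-shapeBD _ _ sl) =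
    threeOfShapeBD _ _ _ X<Y Y<Z (pairAt i) (pairAt j) (pairAt l) si sj sl (pairs-apart i≢j) (pairs-apart j≢l) (pairs-apart i≢l)

  classCount : ℕ
  classCount = 5 * (k * (k * k))

  classIndex : ∀ {i} → Class i → Fin classCount
  classIndex (t , X , Y , Z , _ , X<k , Y<k , Z<k) =
    Fin.combine (tagIndex t) (Fin.combine (fromℕ< X<k) (Fin.combine (fromℕ< Y<k) (fromℕ< Z<k)))

  fromℕ<-injective : ∀ {X Y} (X<k : X < k) (Y<k : Y < k) → fromℕ< X<k ≡ fromℕ< Y<k → X ≡ Y
  fromℕ<-injective X<k Y<k e = trans (≡-sym (FinP.toℕ-fromℕ< X<k)) (trans (cong toℕ e) (FinP.toℕ-fromℕ< Y<k))

  Key : Set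
  Key = Tag × ℕ × ℕ × ℕ

  keyOf : ∀ {i} → Class i → Key
  keyOf (t , X , Y , Z , _) = t , X , Y , Z

  classIndex-injective : ∀ {i j} (κ : Class i) (κ' : Class j) → classIndex κ ≡ classIndex κ' → keyOf κ ≡ keyOf κ'
  classIndex-injective (t , X , Y , Z , _ , X<k , Y<k , Z<k) (t' , X' , Y' , Z' , _ , X'<k , Y'<k , Z'<k) e
    with FinP.combine-injective (tagIndex t) _ (tagIndex t') _ e
  ... | t≡ , rest with FinP.combine-injective (fromℕ< X<k) _ (fromℕ< X'<k) _ rest
  ... | X≡ , rest' with FinP.combine-injective (fromℕ< Y<k) (fromℕ< Z<k) (fromℕ< Y'<k) (fromℕ< Z'<k) rest'
  ... | Y≡ , Z≡ with tagIndex-injective t≡ | fromℕ<-injective X<k X'<k X≡ | fromℕ<-injective Y<k Y'<k Y≡ | fromℕ<-injective Z<k Z'<k Z≡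
  ... | refl | refl | refl | refl = refl

  sameKey : ∀ i j l → i ≢ j → j ≢ l → i ≢ l → (κ : Class i) (κ' : Class j) (κ'' : Class l) →
            keyOf κ ≡ keyOf κ' → keyOf κ' ≡ keyOf κ'' → Short
  sameKey i j l i≢j j≢l i≢l (_ , _ , _ , _ , ev , _) (_ , _ , _ , _ , ev' , _) (_ , _ , _ , _ , ev'' , _) refl refl =
    sameClass i j l i≢j j≢l i≢l ev ev' ev''

  manyPairs : classCount + classCount < m → Short
  manyPairs many with findOrAll pairClass
  ... | inj₁ found = found
  ... | inj₂ class with threeAlike (λ i → classIndex (class i)) many
  ... | i , j , l , i≢j , j≢l , i≢l , e₁ , e₂ =
    sameKey i j l i≢j j≢l i≢l (class i) (class j) (class l)
            (classIndex-injective (class i) (class j) e₁) (classIndex-injective (class j) (class l) e₂)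

5120≤18³ : 5120 ≤ 18 ^ 3
5120≤18³ = m≤m+n 5120 712

10≤18³ : 10 ≤ 18 ^ 3
10≤18³ = m≤m+n 10 5822

cubeBound : ∀ x k m n → 1 ≤ k → x * k ≤ 4 * n → m ≤ 10 * suc k ^ 3 → x ^ 3 * m ≤ 18 ^ 3 * n ^ 3
cubeBound x k m n k≥1 xk≤4n m≤ = begin
  x ^ 3 * m                  ≤⟨ *-monoʳ-≤ (x ^ 3) m≤ ⟩
  x ^ 3 * (10 * suc k ^ 3)   ≤⟨ *-monoʳ-≤ (x ^ 3) (*-monoʳ-≤ 10 (^-monoˡ-≤ 3 k+1≤2k)) ⟩
  x ^ 3 * (10 * (k + k) ^ 3) ≡⟨ double x k ⟩
  80 * (x * k) ^ 3           ≤⟨ *-monoʳ-≤ 80 (^-monoˡ-≤ 3 xk≤4n) ⟩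
  80 * (4 * n) ^ 3           ≡⟨ quadruple n ⟩
  5120 * n ^ 3               ≤⟨ *-monoˡ-≤ (n ^ 3) 5120≤18³ ⟩
  18 ^ 3 * n ^ 3             ∎
  where
  open ≤-Reasoning
  k+1≤2k : suc k ≤ k + k
  k+1≤2k = subst (_≤ k + k) (+-comm k 1) (+-monoʳ-≤ k k≥1)
  -- the ring solver sees the cubes unfolded
  double : ∀ x k → x * (x * (x * 1)) * (10 * ((k + k) * ((k + k) * ((k + k) * 1))))
                   ≡ 80 * ((x * k) * ((x * k) * ((x * k) * 1)))
  double = solve-∀
  quadruple : ∀ n → 80 * ((4 * n) * ((4 * n) * ((4 * n) * 1))) ≡ 5120 * (n * (n * (n * 1)))
  quadruple = solve-∀

-- For m ≤ 10 any cycle will do, since it misses at most n vertices.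
smallBound : ∀ x m n → x ≤ n → m ≤ 10 → x ^ 3 * m ≤ 18 ^ 3 * n ^ 3
smallBound x m n x≤n m≤10 = begin
  x ^ 3 * m     ≤⟨ *-mono-≤ (^-monoˡ-≤ 3 x≤n) m≤10 ⟩
  n ^ 3 * 10    ≡⟨ *-comm (n ^ 3) 10 ⟩
  10 * n ^ 3    ≤⟨ *-monoˡ-≤ (n ^ 3) 10≤18³ ⟩
  18 ^ 3 * n ^ 3 ∎
  where open ≤-Reasoning

cubeGrows : ∀ y → suc y ≤ 10 * suc y ^ 3
cubeGrows y = ≤-trans (m≤m*n (suc y) (suc y ^ 2)) (m≤n*m (suc y * suc y ^ 2) 10)

scaleFrom : ∀ m d j → 10 * j ^ 3 < m → ¬ (10 * (j + d) ^ 3 < m) →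
            Σ ℕ λ k → j ≤ k × 10 * k ^ 3 < m × m ≤ 10 * suc k ^ 3
scaleFrom m zero j below above = ⊥-elim (above (subst (λ z → 10 * z ^ 3 < m) (≡-sym (+-identityʳ j)) below))
scaleFrom m (suc d) j below above with 10 * suc j ^ 3 <? m
... | no stop = j , ≤-refl , below , ≮⇒≥ stop
... | yes next with scaleFrom m d (suc j) next (subst (λ z → ¬ (10 * z ^ 3 < m)) (+-suc j d) above)
...   | k , j<k , k-below , k-above = k , ≤-trans (n≤1+n j) j<k , k-below , k-above

scale : ∀ m → 10 < m → Σ ℕ λ k → 1 ≤ k × 10 * k ^ 3 < m × m ≤ 10 * suc k ^ 3
scale m 10<m = scaleFrom m m 1 10<m (λ z → <⇒≱ z (≤-trans (n≤1+n m) (cubeGrows m)))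

module _ {n : ℕ} {G : Graph n} (C : HamCycle G) {m : ℕ} (I : InterlacedPairs C m) where
  open Configurations C

  Result : Set
  Result = Σ (Cycle G) λ K → DistinctFrom K C × (missed K ^ 3 * m ≤ 18 ^ 3 * n ^ 3)

  -- few pairs: the cycle through one chord of I is good enough
  fewPairs : 1 ≤ m → m ≤ 10 → Result
  fewPairs 1≤m m≤10 = fromGood (oneChord a b a<b b<n ab)
    where
    open ChordPositions.Crossing (PairsOf.pairAt C I (fromℕ< 1≤m))
    fromGood : (Σ ℕ λ g → Good g × g ≤ b ∸ a + 0) → Result
    fromGood (_ , (K , distinct , _) , _) = K , distinct , smallBound (missed K) m n (m∸n≤m n (len K)) m≤10

  manyPairsResult : (Σ ℕ λ k → 1 ≤ k × 10 * k ^ 3 < m × m ≤ 10 * suc k ^ 3) → Result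
  manyPairsResult (k , 1≤k , 10k³<m , m≤) = fromShort (Classification.manyPairs C k 1≤k I (subst (_< m) (≡-sym (twice k)) 10k³<m))
    where
    twice : ∀ k → 5 * (k * (k * k)) + 5 * (k * (k * k)) ≡ 10 * (k * (k * (k * 1)))
    twice = solve-∀
    fromShort : Arcs.Short C k 1≤k → Result
    fromShort (g , (K , distinct , missed≤g) , gk≤4n) =
      K , distinct , cubeBound (missed K) k m n 1≤k (≤-trans (*-monoˡ-≤ k missed≤g) gk≤4n) m≤

  result : 1 ≤ m → Dec (m ≤ 10) → Result
  result 1≤m (yes m≤10) = fewPairs 1≤m m≤10
  result 1≤m (no m≰10) = manyPairsResult (scale m (≰⇒> m≰10))

-- Lemma 3.1, with c = 18: a cycle other than C missing x vertices with
-- x³ m ≤ (18 n)³, i.e. x ≤ 18 n / m^{1/3}.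
lemma3p1 : Σ ℕ λ c → (0 < c) × ((n m : ℕ) → (G : Graph n) → (C : HamCycle G) → 1 ≤ m →
    InterlacedPairs C m →
    Σ (Cycle G) λ K → DistinctFrom K C × (missed K ^ 3 * m ≤ c ^ 3 * n ^ 3))
lemma3p1 = 18 , s≤s z≤n , λ n m G C 1≤m I → result C I 1≤m (m ≤? 10)
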